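{- Let $R,S\in\mathbb{Q}$ and $n,N\in\mathbb{N}$ with $S\neq 0$ and $0\le n\le N$. Set $s:=N-n$ and $Q:=S-R$. Then \[ {}_{N+s}F_{N+s-1}\!\left(\left[\tfrac{Q}{N},\tfrac{Q+1}{N},\dots,\tfrac{Q+N-1}{N},\ \tfrac{S}{s},\dots,\tfrac{S+s-1}{s}\right],\ \left[\tfrac{Q}{s},\dots,\tfrac{Q+s-1}{s},\ 1,\dots,1\right];\ N^N t\right) =\operatorname{Diag}\!\left(\frac{(1-x_1-\dots-x_n)^R}{(1-x_1-\dots-x_N)^S}\right). \] Here the list $\tfrac{S}{s},\dots,\tfrac{S+s-1}{s}$ has $s$ entries, the list $\tfrac{Q}{s},\dots,\tfrac{Q+s-1}{s}$ has $s$ entries, and the bottom row contains $N-1$ entries equal to $1$.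
   Context: All power series have coefficients in $\mathbb{Q}$ (or any field of characteristic zero). For $a\in\mathbb{Q}$ and a power series $L$ with zero constant term, $(1+L)^a:=\sum_{j\ge0}\binom{a}{j}L^j$, where $\binom{a}{j}=a(a-1)\cdots(a-j+1)/j!$. For $g=\sum g_{i_1,\dots,i_N}x_1^{i_1}\cdots x_N^{i_N}$, the diagonal is $\operatorname{Diag}(g):=\sum_{j\ge0}g_{j,\dots,j}t^j$. The generalized hypergeometric function is ${}_pF_q([a_1,\dots,a_p],[b_1,\dots,b_q];t):=\sum_{j\ge0}\frac{(a_1)_j\cdots(a_p)_j}{(b_1)_j\cdots(b_q)_j}\frac{t^j}{j!}$, with $(x)_j=x(x+1)\cdots(x+j-1)$, defined when $b_i+j\neq0$ for all $i$ and all $j\in\mathbb{N}$. -}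

module Defs where

open import Data.Nat as ℕ using (ℕ; zero; suc; _≤_)
open import Data.Integer using (+_)
open import Data.Rational using (ℚ; 0ℚ; 1ℚ; _+_; _*_; _-_; -_; _/_; 1/_; ≢-nonZero)
open import Data.Rational.Properties using (_≟_)
open import Data.Fin using (Fin; toℕ)
open import Data.Vec as Vec using (Vec; []; _∷_; replicate; tabulate)
open import Data.Vec.Properties using (≡-dec)
open import Data.List as List using (List; []; _∷_; _++_; concatMap; upTo; allFin; map; foldr)
open import Data.List.Relation.Unary.All using (All)
open import Data.Product using (_×_; _,_)
open import Data.Bool using (if_then_else_)
open import Relation.Nullary using (yes; no; does)
open import Relation.Binary.PropositionalEquality using (_≡_; _≢_)

ℕ→ℚ : ℕ → ℚ
ℕ→ℚ k = + k / 1

-- total inverse (inv0 0 = 0); only ever applied to nonzero arguments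
-- under the hypotheses of the theorem
inv0 : ℚ → ℚ
inv0 q with q ≟ 0ℚ
... | yes _ = 0ℚ
... | no q≢0 = 1/_ q {{≢-nonZero q≢0}}

Σℚ : List ℚ → ℚ
Σℚ = foldr _+_ 0ℚ

Πℚ : List ℚ → ℚ
Πℚ = foldr _*_ 1ℚ

poch : ℚ → ℕ → ℚ
poch x j = Πℚ (map (λ i → x + ℕ→ℚ i) (upTo j))

factℚ : ℕ → ℚ
factℚ j = Πℚ (map (λ i → ℕ→ℚ (suc i)) (upTo j))

binom : ℚ → ℕ → ℚ
binom a j = Πℚ (map (λ i → a - ℕ→ℚ i) (upTo j)) * inv0 (factℚ j)

PS₁ : Set
PS₁ = ℕ → ℚ

Admissible : List ℚ → Set
Admissible bs = All (λ b → (j : ℕ) → b + ℕ→ℚ j ≢ 0ℚ) bs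

hypergeom : List ℚ → List ℚ → PS₁
hypergeom as bs j =
  Πℚ (map (λ a → poch a j) as) * inv0 (Πℚ (map (λ b → poch b j) bs) * factℚ j)

scaleArg : ℚ → PS₁ → PS₁
scaleArg c f j = f j * Πℚ (map (λ _ → c) (upTo j))

-- Formal power series in N variables x_1..x_N: coefficient functions
-- on exponent vectors

PS : ℕ → Set
PS N = Vec ℕ N → ℚ

deg : ∀ {N} → Vec ℕ N → ℕ
deg = Vec.foldr _ ℕ._+_ 0

splits : ∀ {N} → Vec ℕ N → List (Vec ℕ N × Vec ℕ N)
splits [] = ([] , []) ∷ []
splits (k ∷ e) =
  concatMap (λ i → map (λ { (d , d') → (i ∷ d , (k ℕ.∸ i) ∷ d') }) (splits e))
            (upTo (suc k))

_⊛_ : ∀ {N} → PS N → PS N → PS N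
(f ⊛ g) e = Σℚ (map (λ { (d , d') → f d * g d' }) (splits e))

oneₚ : ∀ {N} → PS N
oneₚ e = if does (≡-dec ℕ._≟_ e (replicate _ 0)) then 1ℚ else 0ℚ

_^ₚ_ : ∀ {N} → PS N → ℕ → PS N
f ^ₚ zero = oneₚ
f ^ₚ suc j = f ⊛ (f ^ₚ j)

-- the variable x_i  (i : Fin N, 0-based)
unitVec : ∀ {N} → Fin N → Vec ℕ N
unitVec i = tabulate (λ k → if does (Data.Fin._≟_ k i) then 1 else 0)

X : ∀ {N} → Fin N → PS N
X i e = if does (≡-dec ℕ._≟_ e (unitVec i)) then 1ℚ else 0ℚ

negSumVars : ∀ {N} → ℕ → PS N
negSumVars {N} m e =
  - Σℚ (map (λ i → if does (toℕ i ℕ.<? m) then X i e else 0ℚ) (allFin N))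

-- (1 + L)^a = Σ_j binom a j L^j for L with zero constant term.
-- The coefficient at e only receives contributions from j ≤ deg e,
-- since L^j has no monomials of degree < j.
binomPow : ∀ {N} → PS N → ℚ → PS N
binomPow L a e = Σℚ (map (λ j → binom a j * (L ^ₚ j) e) (upTo (suc (deg e))))

oneMinusSumPow : ∀ {N} → ℕ → ℚ → PS N
oneMinusSumPow m a = binomPow (negSumVars m) a

Diag : ∀ {N} → PS N → PS₁
Diag {N} g j = g (replicate N j)

fracList : ℚ → ℕ → List ℚ
fracList c d = map (λ k → (c + ℕ→ℚ k) * inv0 (ℕ→ℚ d)) (upTo d)

topParams : (R S : ℚ) (n N : ℕ) → List ℚ
topParams R S n N = fracList (S - R) N ++ fracList S (N ℕ.∸ n)

botParams : (R S : ℚ) (n N : ℕ) → List ℚ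
botParams R S n N =
  fracList (S - R) (N ℕ.∸ n) ++ map (λ _ → 1ℚ) (upTo (N ℕ.∸ 1))

{-# OPTIONS --safe #-}
module Submission where

-- Every series involved is of exponential type: its coefficient at x^d is φ(|d|)/d! if d is
-- supported on the first m variables, and 0 otherwise.  On such series the Cauchy product is
-- the binomial convolution of the φ's (multinomial theorem), and (1 - x₁ - ⋯ - x_m)^a is the
-- one with φ k = (-a)_k.  Hence the hypothesis forces g = (1 - x₁ - ⋯ - x_n)^R (1 - x₁ - ⋯ - x_N)^(-S),
-- whose j-th diagonal coefficient is (S)_{sj} (S - R + sj)_{nj} / j!^N (s = N - n) by Chu–Vandermonde.
-- Gauss' multiplication formula (c)_{dj} = d^{dj} ∏_{k<d} ((c+k)/d)_j turns this into the
-- j-th coefficient of the hypergeometric series at N^N t.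

open import Defs
open import Data.Nat as ℕ using (ℕ; zero; suc; _≤_; _<_; z≤n; s≤s; _∸_; _^_)
import Data.Nat.Properties as ℕP
open import Data.Nat.Divisibility using (∣1⇒≡1)
open import Data.Product using (_,_; _×_; proj₁; proj₂)
import Data.Integer as ℤ
import Data.Integer.Properties as ℤP
open import Data.Rational using (ℚ; 0ℚ; 1ℚ; _+_; _*_; -_; _-_; mkℚ; 1/_; ≢-nonZero)
open import Data.Rational.Properties
open import Data.Rational.Solver using (module +-*-Solver)
open import Data.List as List using (List; []; _∷_; _++_; map; upTo; concatMap)
import Data.List.Properties as LP
open import Data.List.Relation.Unary.All as All using (All; []; _∷_)
import Data.List.Relation.Unary.All.Properties as AllP
open import Data.Vec using (Vec; []; _∷_; replicate; tabulate)
import Data.Vec.Properties as VP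
open import Data.Fin as Fin using (Fin; toℕ)
open import Data.Bool using (Bool; true; false; if_then_else_)
open import Data.Sum using (_⊎_; inj₁; inj₂)
open import Data.Empty using (⊥-elim)
open import Function using (_∘_)
open import Relation.Nullary using (Dec; yes; no; does)
open import Relation.Binary.PropositionalEquality

open +-*-Solver

ℕ→ℚ≡mkℚ : ∀ k → ℕ→ℚ k ≡ mkℚ (ℤ.+ k) 0 (λ (_ , d) → ∣1⇒≡1 d)
ℕ→ℚ≡mkℚ k = normalize-coprime _

ℕ→ℚ-suc : ∀ k → ℕ→ℚ (suc k) ≡ 1ℚ + ℕ→ℚ k
ℕ→ℚ-suc k rewrite ℕ→ℚ≡mkℚ k | ℕP.*-identityʳ k | ℤP.+◃n≡+n k = refl

ℕ→ℚ-+ : ∀ a b → ℕ→ℚ (a ℕ.+ b) ≡ ℕ→ℚ a + ℕ→ℚ b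
ℕ→ℚ-+ zero b = sym (+-identityˡ (ℕ→ℚ b))
ℕ→ℚ-+ (suc a) b = begin
  ℕ→ℚ (suc (a ℕ.+ b))  ≡⟨ ℕ→ℚ-suc (a ℕ.+ b) ⟩
  1ℚ + ℕ→ℚ (a ℕ.+ b)    ≡⟨ cong (1ℚ +_) (ℕ→ℚ-+ a b) ⟩
  1ℚ + (ℕ→ℚ a + ℕ→ℚ b) ≡⟨ sym (+-assoc 1ℚ (ℕ→ℚ a) (ℕ→ℚ b)) ⟩
  (1ℚ + ℕ→ℚ a) + ℕ→ℚ b ≡⟨ cong (_+ ℕ→ℚ b) (sym (ℕ→ℚ-suc a)) ⟩
  ℕ→ℚ (suc a) + ℕ→ℚ b ∎
  where open ≡-Reasoning

ℕ→ℚ-* : ∀ a b → ℕ→ℚ (a ℕ.* b) ≡ ℕ→ℚ a * ℕ→ℚ b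
ℕ→ℚ-* zero b = sym (*-zeroˡ (ℕ→ℚ b))
ℕ→ℚ-* (suc a) b = begin
  ℕ→ℚ (b ℕ.+ a ℕ.* b)  ≡⟨ ℕ→ℚ-+ b (a ℕ.* b) ⟩
  ℕ→ℚ b + ℕ→ℚ (a ℕ.* b) ≡⟨ cong (ℕ→ℚ b +_) (ℕ→ℚ-* a b) ⟩
  ℕ→ℚ b + ℕ→ℚ a * ℕ→ℚ b ≡⟨ solve 2 (λ x y → y :+ x :* y := (con 1ℚ :+ x) :* y) refl (ℕ→ℚ a) (ℕ→ℚ b) ⟩
  (1ℚ + ℕ→ℚ a) * ℕ→ℚ b ≡⟨ cong (_* ℕ→ℚ b) (sym (ℕ→ℚ-suc a)) ⟩
  ℕ→ℚ (suc a) * ℕ→ℚ b ∎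
  where open ≡-Reasoning

ℕ→ℚ-suc≢0 : ∀ k → ℕ→ℚ (suc k) ≢ 0ℚ
ℕ→ℚ-suc≢0 k eq with ℕ→ℚ (suc k) | ℕ→ℚ≡mkℚ (suc k)
... | _ | refl with eq
... | ()

inv0-inverseʳ : ∀ x → x ≢ 0ℚ → x * inv0 x ≡ 1ℚ
inv0-inverseʳ x x≢0 with x ≟ 0ℚ
... | yes x≡0 = ⊥-elim (x≢0 x≡0)
... | no q = *-inverseʳ x {{≢-nonZero q}}

inv0-≡0 : ∀ x → x ≡ 0ℚ → inv0 x ≡ 0ℚ
inv0-≡0 x refl = refl

*-≢0 : ∀ x y → x ≢ 0ℚ → y ≢ 0ℚ → x * y ≢ 0ℚ
*-≢0 x y x0 y0 xy0 = 1≢0 (begin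
    1ℚ ≡⟨ sym (inv0-inverseʳ x x0) ⟩
    x * inv0 x ≡⟨ solve 2 (λ a b → a :* b := a :* (con 1ℚ :* b)) refl x (inv0 x) ⟩
    x * (1ℚ * inv0 x) ≡⟨ cong (λ z → x * (z * inv0 x)) (sym (inv0-inverseʳ y y0)) ⟩
    x * ((y * inv0 y) * inv0 x) ≡⟨ solve 4 (λ a b c d → a :* ((b :* c) :* d) := (a :* b) :* (c :* d)) refl x y (inv0 y) (inv0 x) ⟩
    (x * y) * (inv0 y * inv0 x) ≡⟨ cong (_* (inv0 y * inv0 x)) xy0 ⟩
    0ℚ * (inv0 y * inv0 x) ≡⟨ *-zeroˡ (inv0 y * inv0 x) ⟩
    0ℚ ∎)
  where
  open ≡-Reasoning

inv0-unique : ∀ x y → x * y ≡ 1ℚ → inv0 x ≡ y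
inv0-unique x y xy with x ≟ 0ℚ
... | yes refl = ⊥-elim (z≢1 (trans (sym (*-zeroˡ y)) xy))
  where z≢1 : 0ℚ ≢ 1ℚ
        z≢1 ()
... | no x0 = begin
  1/_ x {{≢-nonZero x0}} ≡⟨ solve 1 (λ a → a := a :* con 1ℚ) refl _ ⟩
  1/_ x {{≢-nonZero x0}} * 1ℚ ≡⟨ cong (1/_ x {{≢-nonZero x0}} *_) (sym xy) ⟩
  1/_ x {{≢-nonZero x0}} * (x * y) ≡⟨ sym (*-assoc (1/_ x {{≢-nonZero x0}}) x y) ⟩
  (1/_ x {{≢-nonZero x0}} * x) * y ≡⟨ cong (_* y) (*-inverseˡ x {{≢-nonZero x0}}) ⟩
  1ℚ * y ≡⟨ *-identityˡ y ⟩
  y ∎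
  where open ≡-Reasoning

inv0-* : ∀ x y → inv0 (x * y) ≡ inv0 x * inv0 y
inv0-* x y = go (x ≟ 0ℚ) (y ≟ 0ℚ)
  where
  open ≡-Reasoning
  go : Dec (x ≡ 0ℚ) → Dec (y ≡ 0ℚ) → inv0 (x * y) ≡ inv0 x * inv0 y
  go (yes x0) _ = trans (inv0-≡0 _ (trans (cong (_* y) x0) (*-zeroˡ y)))
                        (sym (trans (cong (_* inv0 y) (inv0-≡0 x x0)) (*-zeroˡ (inv0 y))))
  go (no _) (yes y0) = trans (inv0-≡0 _ (trans (cong (x *_) y0) (*-zeroʳ x)))
                        (sym (trans (cong (inv0 x *_) (inv0-≡0 y y0)) (*-zeroʳ (inv0 x))))
  go (no x0) (no y0) = inv0-unique (x * y) (inv0 x * inv0 y) (begin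
    x * y * (inv0 x * inv0 y)
      ≡⟨ solve 4 (λ a b c d → a :* b :* (c :* d) := (a :* c) :* (b :* d)) refl x y (inv0 x) (inv0 y) ⟩
    (x * inv0 x) * (y * inv0 y)
      ≡⟨ cong₂ _*_ (inv0-inverseʳ x x0) (inv0-inverseʳ y y0) ⟩
    1ℚ * 1ℚ ≡⟨⟩
    1ℚ ∎)

-- Finite sums and products
private variable A B : Set

Σ∈ : List A → (A → ℚ) → ℚ
Σ∈ L f = Σℚ (map f L)

Σ∈-0 : (L : List A) (f : A → ℚ) → (∀ x → f x ≡ 0ℚ) → Σ∈ L f ≡ 0ℚ
Σ∈-0 [] f eq = refl
Σ∈-0 (x ∷ L) f eq = trans (cong₂ _+_ (eq x) (Σ∈-0 L f eq)) refl

Σ∈-cong : (L : List A) {f g : A → ℚ} → (∀ x → f x ≡ g x) → Σ∈ L f ≡ Σ∈ L g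
Σ∈-cong [] eq = refl
Σ∈-cong (x ∷ L) eq = cong₂ _+_ (eq x) (Σ∈-cong L eq)

Σ∈-+ : (L : List A) (f g : A → ℚ) → Σ∈ L (λ x → f x + g x) ≡ Σ∈ L f + Σ∈ L g
Σ∈-+ [] f g = refl
Σ∈-+ (x ∷ L) f g = trans (cong (f x + g x +_) (Σ∈-+ L f g))
  (solve 4 (λ a b c d → a :+ b :+ (c :+ d) := a :+ c :+ (b :+ d)) refl (f x) (g x) (Σ∈ L f) (Σ∈ L g))

Σ∈-*ˡ : (L : List A) (c : ℚ) (f : A → ℚ) → Σ∈ L (λ x → c * f x) ≡ c * Σ∈ L f
Σ∈-*ˡ [] c f = sym (*-zeroʳ c)
Σ∈-*ˡ (x ∷ L) c f = trans (cong (c * f x +_) (Σ∈-*ˡ L c f))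
  (solve 3 (λ a b d → a :* b :+ a :* d := a :* (b :+ d)) refl c (f x) (Σ∈ L f))

Σ∈-*ʳ : (L : List A) (c : ℚ) (f : A → ℚ) → Σ∈ L (λ x → f x * c) ≡ Σ∈ L f * c
Σ∈-*ʳ L c f = trans (Σ∈-cong L (λ x → *-comm (f x) c)) (trans (Σ∈-*ˡ L c f) (*-comm c (Σ∈ L f)))

Σ∈-++ : (xs ys : List A) (f : A → ℚ) → Σ∈ (xs ++ ys) f ≡ Σ∈ xs f + Σ∈ ys f
Σ∈-++ [] ys f = sym (+-identityˡ (Σ∈ ys f))
Σ∈-++ (x ∷ xs) ys f = trans (cong (f x +_) (Σ∈-++ xs ys f)) (sym (+-assoc (f x) (Σ∈ xs f) (Σ∈ ys f)))

Σ∈-map : {B : Set} (L : List B) (g : B → A) (f : A → ℚ) → Σ∈ (map g L) f ≡ Σ∈ L (f ∘ g)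
Σ∈-map L g f = cong Σℚ (sym (LP.map-∘ L))

Σ∈-concatMap : {B : Set} (L : List B) (G : B → List A) (f : A → ℚ) →
  Σ∈ (concatMap G L) f ≡ Σ∈ L (λ x → Σ∈ (G x) f)
Σ∈-concatMap [] G f = refl
Σ∈-concatMap (x ∷ L) G f = trans (Σ∈-++ (G x) (concatMap G L) f) (cong (Σ∈ (G x) f +_) (Σ∈-concatMap L G f))

Σ∈-swap : {B : Set} (L : List A) (M : List B) (F : A → B → ℚ) →
  Σ∈ L (λ x → Σ∈ M (F x)) ≡ Σ∈ M (λ y → Σ∈ L (λ x → F x y))
Σ∈-swap [] M F = sym (Σ∈-0 M (λ y → 0ℚ) (λ y → refl))
Σ∈-swap (x ∷ L) M F = trans (cong (Σ∈ M (F x) +_) (Σ∈-swap L M F))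
  (sym (Σ∈-+ M (F x) (λ y → Σ∈ L (λ x' → F x' y))))

∑ : ℕ → (ℕ → ℚ) → ℚ
∑ n f = Σ∈ (upTo n) f

∑-first : ∀ n f → ∑ (suc n) f ≡ f 0 + ∑ n (λ i → f (suc i))
∑-first n f = cong (λ l → f 0 + Σℚ l) (trans (LP.map-applyUpTo suc f n) (sym (LP.map-upTo (f ∘ suc) n)))

∑-last : ∀ n f → ∑ (suc n) f ≡ ∑ n f + f n
∑-last n f = begin
  Σ∈ (upTo (suc n)) f ≡⟨ cong (λ l → Σ∈ l f) (sym (LP.upTo-∷ʳ n)) ⟩
  Σ∈ (upTo n ++ (n ∷ [])) f ≡⟨ Σ∈-++ (upTo n) (n ∷ []) f ⟩
  ∑ n f + (f n + 0ℚ) ≡⟨ cong (∑ n f +_) (+-identityʳ (f n)) ⟩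
  ∑ n f + f n ∎
  where open ≡-Reasoning

∑-cong< : ∀ n {f g : ℕ → ℚ} → (∀ i → i < n → f i ≡ g i) → ∑ n f ≡ ∑ n g
∑-cong< zero eq = refl
∑-cong< (suc n) {f} {g} eq = trans (∑-last n f) (trans (cong₂ _+_ (∑-cong< n (λ i i<n → eq i (ℕP.m<n⇒m<1+n i<n))) (eq n (ℕP.n<1+n n))) (sym (∑-last n g)))

∑-zero : ∀ n (f : ℕ → ℚ) → (∀ i → i < n → f i ≡ 0ℚ) → ∑ n f ≡ 0ℚ
∑-zero n f eq = trans (∑-cong< n eq) (Σ∈-0 (upTo n) (λ _ → 0ℚ) (λ _ → refl))

∑-delta : ∀ n p (f : ℕ → ℚ) → p < n → (∀ i → i < n → i ≢ p → f i ≡ 0ℚ) → ∑ n f ≡ f p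
∑-delta zero p f () eq
∑-delta (suc n) p f p<n eq with p ℕP.≟ n
... | yes refl = trans (∑-last n f) (trans (cong (_+ f n) (∑-zero n f (λ i i<n → eq i (ℕP.m<n⇒m<1+n i<n) (λ i≡n → ℕP.<-irrefl i≡n i<n)))) (+-identityˡ (f n)))
... | no p≢n = trans (∑-last n f) (trans (cong₂ _+_ (∑-delta n p f (ℕP.≤∧≢⇒< (ℕP.≤-pred p<n) p≢n) (λ i i<n → eq i (ℕP.m<n⇒m<1+n i<n))) (eq n (ℕP.n<1+n n) (λ n≡p → p≢n (sym n≡p)))) (+-identityʳ (f p)))

∑-+ : ∀ n f g → ∑ n (λ i → f i + g i) ≡ ∑ n f + ∑ n g
∑-+ n f g = Σ∈-+ (upTo n) f g

∑-triangle : ∀ k (T : ℕ → ℕ → ℕ → ℚ) →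
  ∑ (suc k) (λ i → ∑ (suc i) (λ a → T a (i ∸ a) (k ∸ i))) ≡
  ∑ (suc k) (λ a → ∑ (suc (k ∸ a)) (λ b → T a b (k ∸ a ∸ b)))
∑-triangle zero T = refl
∑-triangle (suc k) T = begin
  ∑ (suc (suc k)) (λ i → ∑ (suc i) (λ a → T a (i ∸ a) (suc k ∸ i)))
    ≡⟨ ∑-cong< (suc (suc k)) (λ i _ → ∑-first i (λ a → T a (i ∸ a) (suc k ∸ i))) ⟩
  ∑ (suc (suc k)) (λ i → T 0 i (suc k ∸ i) + ∑ i (λ a → T (suc a) (i ∸ suc a) (suc k ∸ i)))
    ≡⟨ ∑-+ (suc (suc k)) (λ i → T 0 i (suc k ∸ i)) (λ i → ∑ i (λ a → T (suc a) (i ∸ suc a) (suc k ∸ i))) ⟩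
  ∑ (suc (suc k)) (λ i → T 0 i (suc k ∸ i)) + ∑ (suc (suc k)) (λ i → ∑ i (λ a → T (suc a) (i ∸ suc a) (suc k ∸ i)))
    ≡⟨ cong (∑ (suc (suc k)) (λ i → T 0 i (suc k ∸ i)) +_) (trans (∑-first (suc k) (λ i → ∑ i (λ a → T (suc a) (i ∸ suc a) (suc k ∸ i)))) (+-identityˡ (∑ (suc k) (λ i → ∑ (suc i) (λ a → T (suc a) (i ∸ a) (k ∸ i)))))) ⟩
  ∑ (suc (suc k)) (λ i → T 0 i (suc k ∸ i)) + ∑ (suc k) (λ i → ∑ (suc i) (λ a → T (suc a) (i ∸ a) (k ∸ i)))
    ≡⟨ cong (∑ (suc (suc k)) (λ i → T 0 i (suc k ∸ i)) +_) (∑-triangle k (λ a → T (suc a))) ⟩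
  ∑ (suc (suc k)) (λ b → T 0 b (suc k ∸ b)) + ∑ (suc k) (λ a → ∑ (suc (k ∸ a)) (λ b → T (suc a) b (k ∸ a ∸ b)))
    ≡⟨ sym (∑-first (suc k) (λ a → ∑ (suc (suc k ∸ a)) (λ b → T a b (suc k ∸ a ∸ b)))) ⟩
  ∑ (suc (suc k)) (λ a → ∑ (suc (suc k ∸ a)) (λ b → T a b (suc k ∸ a ∸ b))) ∎
  where open ≡-Reasoning

∏ : ℕ → (ℕ → ℚ) → ℚ
∏ n f = Πℚ (map f (upTo n))

Πℚ-++ : (xs ys : List ℚ) → Πℚ (xs ++ ys) ≡ Πℚ xs * Πℚ ys
Πℚ-++ [] ys = sym (*-identityˡ (Πℚ ys))
Πℚ-++ (x ∷ xs) ys = trans (cong (x *_) (Πℚ-++ xs ys)) (sym (*-assoc x (Πℚ xs) (Πℚ ys)))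

Πℚ-≢0 : ∀ xs → All (λ x → x ≢ 0ℚ) xs → Πℚ xs ≢ 0ℚ
Πℚ-≢0 [] [] ()
Πℚ-≢0 (x ∷ xs) (px ∷ pxs) = *-≢0 x (Πℚ xs) px (Πℚ-≢0 xs pxs)

∏-first : ∀ n f → ∏ (suc n) f ≡ f 0 * ∏ n (λ i → f (suc i))
∏-first n f = cong (λ l → f 0 * Πℚ l) (trans (LP.map-applyUpTo suc f n) (sym (LP.map-upTo (f ∘ suc) n)))

∏-last : ∀ n f → ∏ (suc n) f ≡ ∏ n f * f n
∏-last n f = begin
  Πℚ (map f (upTo (suc n))) ≡⟨ cong (λ l → Πℚ (map f l)) (sym (LP.upTo-∷ʳ n)) ⟩
  Πℚ (map f (upTo n ++ (n ∷ []))) ≡⟨ cong Πℚ (LP.map-++ f (upTo n) (n ∷ [])) ⟩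
  Πℚ (map f (upTo n) ++ (f n ∷ [])) ≡⟨ Πℚ-++ (map f (upTo n)) (f n ∷ []) ⟩
  ∏ n f * (f n * 1ℚ) ≡⟨ cong (∏ n f *_) (*-identityʳ (f n)) ⟩
  ∏ n f * f n ∎
  where open ≡-Reasoning

∏-cong : ∀ n {f g : ℕ → ℚ} → (∀ i → f i ≡ g i) → ∏ n f ≡ ∏ n g
∏-cong n eq = cong Πℚ (LP.map-cong eq (upTo n))

∏-* : ∀ n f g → ∏ n (λ i → f i * g i) ≡ ∏ n f * ∏ n g
∏-* zero f g = refl
∏-* (suc n) f g = trans (∏-last n _) (trans (cong (_* (f n * g n)) (∏-* n f g))
  (trans (solve 4 (λ a b c d → (a :* b) :* (c :* d) := (a :* c) :* (b :* d)) refl (∏ n f) (∏ n g) (f n) (g n))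
  (sym (cong₂ _*_ (∏-last n f) (∏-last n g)))))

∏-+ : ∀ a b f → ∏ (a ℕ.+ b) f ≡ ∏ a f * ∏ b (λ i → f (a ℕ.+ i))
∏-+ zero b f = sym (*-identityˡ (∏ b f))
∏-+ (suc a) b f = begin
  ∏ (suc (a ℕ.+ b)) f ≡⟨ ∏-first (a ℕ.+ b) f ⟩
  f 0 * ∏ (a ℕ.+ b) (λ i → f (suc i)) ≡⟨ cong (f 0 *_) (∏-+ a b (λ i → f (suc i))) ⟩
  f 0 * (∏ a (λ i → f (suc i)) * ∏ b (λ i → f (suc (a ℕ.+ i)))) ≡⟨ sym (*-assoc (f 0) _ _) ⟩
  f 0 * ∏ a (λ i → f (suc i)) * ∏ b (λ i → f (suc (a ℕ.+ i))) ≡⟨ cong (_* ∏ b (λ i → f (suc (a ℕ.+ i)))) (sym (∏-first a f)) ⟩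
  ∏ (suc a) f * ∏ b (λ i → f (suc a ℕ.+ i)) ∎
  where open ≡-Reasoning

∏-≢0 : ∀ n f → (∀ i → i < n → f i ≢ 0ℚ) → ∏ n f ≢ 0ℚ
∏-≢0 zero f h ()
∏-≢0 (suc n) f h eq = *-≢0 (∏ n f) (f n) (∏-≢0 n f (λ i i<n → h i (ℕP.m<n⇒m<1+n i<n))) (h n (ℕP.n<1+n n)) (trans (sym (∏-last n f)) eq)

powℚ : ℚ → ℕ → ℚ
powℚ c n = ∏ n (λ _ → c)

powℚ-+ : ∀ c a b → powℚ c (a ℕ.+ b) ≡ powℚ c a * powℚ c b
powℚ-+ c a b = ∏-+ a b (λ _ → c)

powℚ-1 : ∀ n → powℚ 1ℚ n ≡ 1ℚ
powℚ-1 zero = refl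
powℚ-1 (suc n) = trans (∏-last n (λ _ → 1ℚ)) (trans (*-identityʳ (powℚ 1ℚ n)) (powℚ-1 n))

powℚ-* : ∀ x a b → powℚ (powℚ x a) b ≡ powℚ x (a ℕ.* b)
powℚ-* x a zero = cong (powℚ x) (sym (ℕP.*-zeroʳ a))
powℚ-* x a (suc b) = begin
  powℚ (powℚ x a) (suc b) ≡⟨ ∏-last b (λ _ → powℚ x a) ⟩
  powℚ (powℚ x a) b * powℚ x a ≡⟨ cong (_* powℚ x a) (powℚ-* x a b) ⟩
  powℚ x (a ℕ.* b) * powℚ x a ≡⟨ sym (powℚ-+ x (a ℕ.* b) a) ⟩
  powℚ x (a ℕ.* b ℕ.+ a) ≡⟨ cong (powℚ x) (trans (ℕP.+-comm (a ℕ.* b) a) (sym (ℕP.*-suc a b))) ⟩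
  powℚ x (a ℕ.* suc b) ∎
  where open ≡-Reasoning

ℕ→ℚ-^ : ∀ a b → ℕ→ℚ (a ℕ.^ b) ≡ powℚ (ℕ→ℚ a) b
ℕ→ℚ-^ a zero = refl
ℕ→ℚ-^ a (suc b) = trans (ℕ→ℚ-* a (a ℕ.^ b)) (trans (cong (ℕ→ℚ a *_) (ℕ→ℚ-^ a b))
  (trans (*-comm (ℕ→ℚ a) (powℚ (ℕ→ℚ a) b)) (sym (∏-last b (λ _ → ℕ→ℚ a)))))

inv0-powℚ : ∀ x n → inv0 (powℚ x n) ≡ powℚ (inv0 x) n
inv0-powℚ x zero = refl
inv0-powℚ x (suc n) = trans (cong inv0 (∏-last n (λ _ → x))) (trans (inv0-* (powℚ x n) x)
  (trans (cong (_* inv0 x) (inv0-powℚ x n)) (sym (∏-last n (λ _ → inv0 x)))))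

invFact : ℕ → ℚ
invFact k = inv0 (factℚ k)

factℚ-suc : ∀ k → factℚ (suc k) ≡ factℚ k * ℕ→ℚ (suc k)
factℚ-suc k = ∏-last k (λ i → ℕ→ℚ (suc i))

factℚ≢0 : ∀ k → factℚ k ≢ 0ℚ
factℚ≢0 k = ∏-≢0 k (λ i → ℕ→ℚ (suc i)) (λ i _ → ℕ→ℚ-suc≢0 i)

invFact-suc : ∀ k → ℕ→ℚ (suc k) * invFact (suc k) ≡ invFact k
invFact-suc k = begin
  ℕ→ℚ (suc k) * inv0 (factℚ (suc k)) ≡⟨ cong (λ z → ℕ→ℚ (suc k) * inv0 z) (factℚ-suc k) ⟩
  ℕ→ℚ (suc k) * inv0 (factℚ k * ℕ→ℚ (suc k)) ≡⟨ cong (ℕ→ℚ (suc k) *_) (inv0-* (factℚ k) (ℕ→ℚ (suc k))) ⟩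
  ℕ→ℚ (suc k) * (inv0 (factℚ k) * inv0 (ℕ→ℚ (suc k))) ≡⟨ solve 3 (λ a b c → a :* (b :* c) := b :* (a :* c)) refl (ℕ→ℚ (suc k)) (inv0 (factℚ k)) (inv0 (ℕ→ℚ (suc k))) ⟩
  inv0 (factℚ k) * (ℕ→ℚ (suc k) * inv0 (ℕ→ℚ (suc k))) ≡⟨ cong (inv0 (factℚ k) *_) (inv0-inverseʳ (ℕ→ℚ (suc k)) (ℕ→ℚ-suc≢0 k)) ⟩
  inv0 (factℚ k) * 1ℚ ≡⟨ *-identityʳ (inv0 (factℚ k)) ⟩
  invFact k ∎
  where open ≡-Reasoning

-- Pochhammer symbols
δ₀ : ℕ → ℚ
δ₀ zero = 1ℚ
δ₀ (suc _) = 0ℚ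

δ₀-pos : ∀ n → 0 < n → δ₀ n ≡ 0ℚ
δ₀-pos (suc n) _ = refl

poch-last : ∀ z j → poch z (suc j) ≡ poch z j * (z + ℕ→ℚ j)
poch-last z j = ∏-last j (λ i → z + ℕ→ℚ i)

poch-first : ∀ z j → poch z (suc j) ≡ z * poch (z + 1ℚ) j
poch-first z j = trans (∏-first j (λ i → z + ℕ→ℚ i))
  (cong₂ _*_ (+-identityʳ z) (∏-cong j (λ i → trans (cong (z +_) (ℕ→ℚ-suc i)) (sym (+-assoc z 1ℚ (ℕ→ℚ i))))))

poch-+ : ∀ z a b → poch z (a ℕ.+ b) ≡ poch z a * poch (z + ℕ→ℚ a) b
poch-+ z a b = trans (∏-+ a b (λ i → z + ℕ→ℚ i))
  (cong (poch z a *_) (∏-cong b (λ i → trans (cong (z +_) (ℕ→ℚ-+ a i)) (sym (+-assoc z (ℕ→ℚ a) (ℕ→ℚ i))))))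

poch0≡δ₀ : ∀ K → poch 0ℚ K ≡ δ₀ K
poch0≡δ₀ zero = refl
poch0≡δ₀ (suc K) = trans (poch-first 0ℚ K) (*-zeroˡ (poch (0ℚ + 1ℚ) K))

frac : ℚ → ℕ → ℕ → ℚ
frac c d k = (c + ℕ→ℚ k) * inv0 (ℕ→ℚ d)

gauss-multiplication-∏ : ∀ d c j → ∏ d (λ k → poch (frac c d k) j) * powℚ (ℕ→ℚ d) (d ℕ.* j) ≡ poch c (d ℕ.* j)
gauss-multiplication-∏ zero c j = *-identityˡ 1ℚ
gauss-multiplication-∏ (suc d') c zero rewrite ℕP.*-zeroʳ d' = trans (*-identityʳ (powℚ 1ℚ (suc d'))) (powℚ-1 (suc d'))
gauss-multiplication-∏ (suc d') c (suc j) = begin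
  ∏ d (λ k → poch (f k) (suc j)) * powℚ D (d ℕ.* suc j)
    ≡⟨ cong₂ _*_ (∏-cong d (λ k → poch-last (f k) j)) (cong (powℚ D) d[1+j]) ⟩
  ∏ d (λ k → poch (f k) j * (f k + ℕ→ℚ j)) * powℚ D (d ℕ.* j ℕ.+ d)
    ≡⟨ cong₂ _*_ (∏-* d (λ k → poch (f k) j) (λ k → f k + ℕ→ℚ j)) (powℚ-+ D (d ℕ.* j) d) ⟩
  ∏ d (λ k → poch (f k) j) * ∏ d (λ k → f k + ℕ→ℚ j) * (powℚ D (d ℕ.* j) * powℚ D d)
    ≡⟨ solve 4 (λ a b c e → a :* b :* (c :* e) := a :* c :* (b :* e)) refl (∏ d (λ k → poch (f k) j)) (∏ d (λ k → f k + ℕ→ℚ j)) (powℚ D (d ℕ.* j)) (powℚ D d) ⟩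
  ∏ d (λ k → poch (f k) j) * powℚ D (d ℕ.* j) * (∏ d (λ k → f k + ℕ→ℚ j) * powℚ D d)
    ≡⟨ cong₂ _*_ (gauss-multiplication-∏ d c j) (sym (∏-* d (λ k → f k + ℕ→ℚ j) (λ _ → D))) ⟩
  poch c (d ℕ.* j) * ∏ d (λ k → (f k + ℕ→ℚ j) * D)
    ≡⟨ cong (poch c (d ℕ.* j) *_) (∏-cong d scaled) ⟩
  poch c (d ℕ.* j) * poch (c + ℕ→ℚ (d ℕ.* j)) d ≡⟨ sym (poch-+ c (d ℕ.* j) d) ⟩
  poch c (d ℕ.* j ℕ.+ d) ≡⟨ cong (poch c) (sym d[1+j]) ⟩
  poch c (d ℕ.* suc j) ∎
  where
  open ≡-Reasoning
  d : ℕ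
  d = suc d'
  D : ℚ
  D = ℕ→ℚ d
  f : ℕ → ℚ
  f = frac c d
  d[1+j] : d ℕ.* suc j ≡ d ℕ.* j ℕ.+ d
  d[1+j] = trans (ℕP.*-suc d j) (ℕP.+-comm d (d ℕ.* j))
  scaled : ∀ k → (f k + ℕ→ℚ j) * D ≡ c + ℕ→ℚ (d ℕ.* j) + ℕ→ℚ k
  scaled k = begin
    ((c + ℕ→ℚ k) * inv0 D + ℕ→ℚ j) * D
      ≡⟨ solve 5 (λ c k i j D → ((c :+ k) :* i :+ j) :* D := (c :+ k) :* (D :* i) :+ D :* j) refl c (ℕ→ℚ k) (inv0 D) (ℕ→ℚ j) D ⟩
    (c + ℕ→ℚ k) * (D * inv0 D) + D * ℕ→ℚ j ≡⟨ cong₂ (λ u v → (c + ℕ→ℚ k) * u + v) (inv0-inverseʳ D (ℕ→ℚ-suc≢0 d')) (sym (ℕ→ℚ-* d j)) ⟩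
    (c + ℕ→ℚ k) * 1ℚ + ℕ→ℚ (d ℕ.* j)
      ≡⟨ solve 3 (λ c k x → (c :+ k) :* con 1ℚ :+ x := c :+ x :+ k) refl c (ℕ→ℚ k) (ℕ→ℚ (d ℕ.* j)) ⟩
    c + ℕ→ℚ (d ℕ.* j) + ℕ→ℚ k ∎

pochProd : ℕ → List ℚ → ℚ
pochProd j xs = Πℚ (map (λ a → poch a j) xs)

pochProd-++ : ∀ j xs ys → pochProd j (xs ++ ys) ≡ pochProd j xs * pochProd j ys
pochProd-++ j xs ys = trans (cong Πℚ (LP.map-++ (λ a → poch a j) xs ys)) (Πℚ-++ (map (λ a → poch a j) xs) (map (λ a → poch a j) ys))

gauss-multiplication : ∀ c d j → pochProd j (fracList c d) * powℚ (ℕ→ℚ d) (d ℕ.* j) ≡ poch c (d ℕ.* j)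
gauss-multiplication c d j = trans (cong (λ t → Πℚ t * powℚ (ℕ→ℚ d) (d ℕ.* j)) (sym (LP.map-∘ (upTo d)))) (gauss-multiplication-∏ d c j)

-- Binomial convolution
Kernel : Set
Kernel = ℕ → ℕ → ℚ

pascal : Kernel → Kernel
pascal Φ x y = Φ (suc x) y + Φ x (suc y)

-- binomSum K Φ x y = Σᵢ C(K,i) Φ (x+i) (y+K-i), generated by Pascal's rule.
binomSum : ℕ → Kernel → Kernel
binomSum zero Φ = Φ
binomSum (suc a) Φ = binomSum a (pascal Φ)

binomSum-cong : ∀ a {Φ Ψ : Kernel} → (∀ x y → Φ x y ≡ Ψ x y) → ∀ x y → binomSum a Φ x y ≡ binomSum a Ψ x y
binomSum-cong zero eq x y = eq x y
binomSum-cong (suc a) {Φ} {Ψ} eq = binomSum-cong a (λ x y → cong₂ _+_ (eq (suc x) y) (eq x (suc y)))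

binomSum-+ : ∀ a b Φ → binomSum (a ℕ.+ b) Φ ≡ binomSum b (binomSum a Φ)
binomSum-+ zero b Φ = refl
binomSum-+ (suc a) b Φ = binomSum-+ a b (pascal Φ)

binomSum-shift : ∀ a Φ p q x y → binomSum a (λ x y → Φ (p ℕ.+ x) (q ℕ.+ y)) x y ≡ binomSum a Φ (p ℕ.+ x) (q ℕ.+ y)
binomSum-shift zero Φ p q x y = refl
binomSum-shift (suc a) Φ p q x y = trans
  (binomSum-cong a {pascal (λ x y → Φ (p ℕ.+ x) (q ℕ.+ y))} {λ x y → pascal Φ (p ℕ.+ x) (q ℕ.+ y)}
     (λ x y → cong₂ _+_ (cong (λ z → Φ z (q ℕ.+ y)) (ℕP.+-suc p x)) (cong (Φ (p ℕ.+ x)) (ℕP.+-suc q y))) x y)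
  (binomSum-shift a (pascal Φ) p q x y)

binomSum-nest : ∀ k l c Φ → binomSum k (λ x y → binomSum l Φ x (y ℕ.+ c)) 0 0 ≡ binomSum (k ℕ.+ l) Φ 0 c
binomSum-nest k l c Φ = begin
  binomSum k (λ x y → binomSum l Φ x (y ℕ.+ c)) 0 0
    ≡⟨ binomSum-cong k (λ x y → cong (binomSum l Φ x) (ℕP.+-comm y c)) 0 0 ⟩
  binomSum k (λ x y → binomSum l Φ (0 ℕ.+ x) (c ℕ.+ y)) 0 0 ≡⟨ binomSum-shift k (binomSum l Φ) 0 c 0 0 ⟩
  binomSum k (binomSum l Φ) 0 (c ℕ.+ 0)                      ≡⟨ cong (λ f → f 0 (c ℕ.+ 0)) (sym (binomSum-+ l k Φ)) ⟩
  binomSum (l ℕ.+ k) Φ 0 (c ℕ.+ 0)                          ≡⟨ cong₂ (λ s t → binomSum s Φ 0 t) (ℕP.+-comm l k) (ℕP.+-identityʳ c) ⟩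
  binomSum (k ℕ.+ l) Φ 0 c ∎
  where open ≡-Reasoning

expConv : ℕ → Kernel → ℚ
expConv k Ψ = ∑ (suc k) (λ i → Ψ i (k ∸ i) * (invFact i * invFact (k ∸ i)))

expConv-suc : ∀ k Ψ → expConv (suc k) Ψ * ℕ→ℚ (suc k) ≡ expConv k (pascal Ψ)
expConv-suc k Ψ = begin
  expConv (suc k) Ψ * ℕ→ℚ (suc k)
    ≡⟨ sym (Σ∈-*ʳ (upTo (suc (suc k))) (ℕ→ℚ (suc k)) (λ i → W i)) ⟩
  ∑ (suc (suc k)) (λ i → W i * ℕ→ℚ (suc k))
    ≡⟨ ∑-cong< (suc (suc k)) (λ i i<n → trans (cong (λ z → W i * ℕ→ℚ z) (sym (ℕP.m+[n∸m]≡n (ℕP.≤-pred i<n))))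
                                          (trans (cong (W i *_) (ℕ→ℚ-+ i (suc k ∸ i)))
                                           (*-distribˡ-+ (W i) (ℕ→ℚ i) (ℕ→ℚ (suc k ∸ i))))) ⟩
  ∑ (suc (suc k)) (λ i → W i * ℕ→ℚ i + W i * ℕ→ℚ (suc k ∸ i))
    ≡⟨ ∑-+ (suc (suc k)) (λ i → W i * ℕ→ℚ i) (λ i → W i * ℕ→ℚ (suc k ∸ i)) ⟩
  ∑ (suc (suc k)) (λ i → W i * ℕ→ℚ i) + ∑ (suc (suc k)) (λ i → W i * ℕ→ℚ (suc k ∸ i))
    ≡⟨ cong₂ _+_ absorb-i absorb-k∸i ⟩
  ∑ (suc k) (λ i → Ψ (suc i) (k ∸ i) * (invFact i * invFact (k ∸ i))) + ∑ (suc k) (λ i → Ψ i (suc (k ∸ i)) * (invFact i * invFact (k ∸ i)))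
    ≡⟨ sym (∑-+ (suc k) (λ i → Ψ (suc i) (k ∸ i) * (invFact i * invFact (k ∸ i))) (λ i → Ψ i (suc (k ∸ i)) * (invFact i * invFact (k ∸ i)))) ⟩
  ∑ (suc k) (λ i → Ψ (suc i) (k ∸ i) * (invFact i * invFact (k ∸ i)) + Ψ i (suc (k ∸ i)) * (invFact i * invFact (k ∸ i)))
    ≡⟨ Σ∈-cong (upTo (suc k)) (λ i → sym (*-distribʳ-+ (invFact i * invFact (k ∸ i)) (Ψ (suc i) (k ∸ i)) (Ψ i (suc (k ∸ i))))) ⟩
  expConv k (pascal Ψ) ∎
  where
  open ≡-Reasoning
  W : ℕ → ℚ
  W i = Ψ i (suc k ∸ i) * (invFact i * invFact (suc k ∸ i))
  absorb-i : ∑ (suc (suc k)) (λ i → W i * ℕ→ℚ i) ≡ ∑ (suc k) (λ i → Ψ (suc i) (k ∸ i) * (invFact i * invFact (k ∸ i)))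
  absorb-i = trans (∑-first (suc k) (λ i → W i * ℕ→ℚ i))
      (trans (cong (_+ ∑ (suc k) (λ i → W (suc i) * ℕ→ℚ (suc i))) (*-zeroʳ (W 0)))
      (trans (+-identityˡ (∑ (suc k) (λ i → W (suc i) * ℕ→ℚ (suc i))))
      (Σ∈-cong (upTo (suc k)) (λ i →
         trans (solve 4 (λ a b c d → a :* (b :* c) :* d := a :* ((d :* b) :* c)) refl (Ψ (suc i) (k ∸ i)) (invFact (suc i)) (invFact (k ∸ i)) (ℕ→ℚ (suc i)))
               (cong (λ z → Ψ (suc i) (k ∸ i) * (z * invFact (k ∸ i))) (invFact-suc i))))))
  absorb-k∸i : ∑ (suc (suc k)) (λ i → W i * ℕ→ℚ (suc k ∸ i)) ≡ ∑ (suc k) (λ i → Ψ i (suc (k ∸ i)) * (invFact i * invFact (k ∸ i)))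
  absorb-k∸i = trans (∑-last (suc k) (λ i → W i * ℕ→ℚ (suc k ∸ i)))
      (trans (cong (∑ (suc k) (λ i → W i * ℕ→ℚ (suc k ∸ i)) +_)
               (trans (cong (λ z → W (suc k) * ℕ→ℚ z) (ℕP.n∸n≡0 k)) (*-zeroʳ (W (suc k)))))
      (trans (+-identityʳ (∑ (suc k) (λ i → W i * ℕ→ℚ (suc k ∸ i))))
      (∑-cong< (suc k) (λ i i<n →
         let e = ℕP.+-∸-assoc 1 (ℕP.≤-pred i<n) in
         trans (cong (λ z → Ψ i z * (invFact i * invFact z) * ℕ→ℚ z) e)
         (trans (solve 4 (λ a b c d → a :* (b :* c) :* d := a :* (b :* (d :* c))) refl (Ψ i (suc (k ∸ i))) (invFact i) (invFact (suc (k ∸ i))) (ℕ→ℚ (suc (k ∸ i))))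
                (cong (λ z → Ψ i (suc (k ∸ i)) * (invFact i * z)) (invFact-suc (k ∸ i))))))))

expConv≡binomSum : ∀ k Ψ → expConv k Ψ ≡ binomSum k Ψ 0 0 * invFact k
expConv≡binomSum zero Ψ = solve 1 (λ a → a :* (con 1ℚ :* con 1ℚ) :+ con 0ℚ := a :* con 1ℚ) refl (Ψ 0 0)
expConv≡binomSum (suc k) Ψ = begin
  expConv (suc k) Ψ ≡⟨ solve 1 (λ a → a := a :* con 1ℚ) refl (expConv (suc k) Ψ) ⟩
  expConv (suc k) Ψ * 1ℚ ≡⟨ cong (expConv (suc k) Ψ *_) (sym (inv0-inverseʳ (ℕ→ℚ (suc k)) (ℕ→ℚ-suc≢0 k))) ⟩
  expConv (suc k) Ψ * (ℕ→ℚ (suc k) * inv0 (ℕ→ℚ (suc k))) ≡⟨ sym (*-assoc (expConv (suc k) Ψ) (ℕ→ℚ (suc k)) (inv0 (ℕ→ℚ (suc k)))) ⟩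
  expConv (suc k) Ψ * ℕ→ℚ (suc k) * inv0 (ℕ→ℚ (suc k)) ≡⟨ cong (_* inv0 (ℕ→ℚ (suc k))) (trans (expConv-suc k Ψ) (expConv≡binomSum k (pascal Ψ))) ⟩
  binomSum k (pascal Ψ) 0 0 * invFact k * inv0 (ℕ→ℚ (suc k)) ≡⟨ *-assoc (binomSum k (pascal Ψ) 0 0) (invFact k) (inv0 (ℕ→ℚ (suc k))) ⟩
  binomSum k (pascal Ψ) 0 0 * (invFact k * inv0 (ℕ→ℚ (suc k))) ≡⟨ cong (binomSum k (pascal Ψ) 0 0 *_) (sym (trans (cong inv0 (factℚ-suc k)) (inv0-* (factℚ k) (ℕ→ℚ (suc k))))) ⟩
  binomSum (suc k) Ψ 0 0 * invFact (suc k) ∎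
  where open ≡-Reasoning

binomSum≡expConv*fact : ∀ K Φ → binomSum K Φ 0 0 ≡ expConv K Φ * factℚ K
binomSum≡expConv*fact K Φ = begin
  binomSum K Φ 0 0 ≡⟨ sym (*-identityʳ _) ⟩
  binomSum K Φ 0 0 * 1ℚ ≡⟨ cong (binomSum K Φ 0 0 *_) (sym (trans (*-comm (invFact K) (factℚ K)) (inv0-inverseʳ (factℚ K) (factℚ≢0 K)))) ⟩
  binomSum K Φ 0 0 * (invFact K * factℚ K) ≡⟨ sym (*-assoc (binomSum K Φ 0 0) (invFact K) (factℚ K)) ⟩
  binomSum K Φ 0 0 * invFact K * factℚ K ≡⟨ cong (_* factℚ K) (sym (expConv≡binomSum K Φ)) ⟩
  expConv K Φ * factℚ K ∎
  where open ≡-Reasoning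

-- The extra factor (α+β+x+y)_m makes the statement stable under one Pascal step.
chuVandermonde-gen : ∀ K m α β x y →
  binomSum K (λ x y → poch α x * poch β y * poch (α + β + ℕ→ℚ x + ℕ→ℚ y) m) x y ≡
  poch α x * poch β y * poch (α + β + ℕ→ℚ x + ℕ→ℚ y) (m ℕ.+ K)
chuVandermonde-gen zero m α β x y = cong (λ t → poch α x * poch β y * poch (α + β + ℕ→ℚ x + ℕ→ℚ y) t) (sym (ℕP.+-identityʳ m))
chuVandermonde-gen (suc K) m α β x y = begin
  binomSum K (pascal Φ) x y ≡⟨ binomSum-cong K {pascal Φ} {Φ'} step x y ⟩
  binomSum K Φ' x y ≡⟨ chuVandermonde-gen K (suc m) α β x y ⟩
  poch α x * poch β y * poch (α + β + ℕ→ℚ x + ℕ→ℚ y) (suc m ℕ.+ K) ≡⟨ cong (λ t → poch α x * poch β y * poch (α + β + ℕ→ℚ x + ℕ→ℚ y) t) (sym (ℕP.+-suc m K)) ⟩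
  poch α x * poch β y * poch (α + β + ℕ→ℚ x + ℕ→ℚ y) (m ℕ.+ suc K) ∎
  where
  open ≡-Reasoning
  Φ Φ' : Kernel
  Φ x y = poch α x * poch β y * poch (α + β + ℕ→ℚ x + ℕ→ℚ y) m
  Φ' x y = poch α x * poch β y * poch (α + β + ℕ→ℚ x + ℕ→ℚ y) (suc m)
  step : ∀ x y → pascal Φ x y ≡ Φ' x y
  step x y = begin
    poch α (suc x) * poch β y * poch (α + β + ℕ→ℚ (suc x) + ℕ→ℚ y) m + poch α x * poch β (suc y) * poch (α + β + ℕ→ℚ x + ℕ→ℚ (suc y)) m
      ≡⟨ cong₂ _+_ (cong₂ (λ u v → u * poch β y * poch v m) (poch-last α x) γ[1+x])
                   (cong₂ (λ u v → poch α x * u * poch v m) (poch-last β y) γ[1+y]) ⟩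
    poch α x * (α + ℕ→ℚ x) * poch β y * P + poch α x * (poch β y * (β + ℕ→ℚ y)) * P
      ≡⟨ solve 6 (λ a ax b by g p → a :* ax :* b :* p :+ a :* (b :* by) :* p := a :* b :* ((ax :+ by) :* p)) refl
            (poch α x) (α + ℕ→ℚ x) (poch β y) (β + ℕ→ℚ y) γ P ⟩
    poch α x * poch β y * ((α + ℕ→ℚ x + (β + ℕ→ℚ y)) * P)
      ≡⟨ cong (λ u → poch α x * poch β y * (u * P)) (solve 4 (λ a b c d → a :+ c :+ (b :+ d) := a :+ b :+ c :+ d) refl α β (ℕ→ℚ x) (ℕ→ℚ y)) ⟩
    poch α x * poch β y * (γ * P)
      ≡⟨ cong (poch α x * poch β y *_) (sym (poch-first γ m)) ⟩
    Φ' x y ∎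
    where
    γ P : ℚ
    γ = α + β + ℕ→ℚ x + ℕ→ℚ y
    P = poch (γ + 1ℚ) m
    γ[1+x] : α + β + ℕ→ℚ (suc x) + ℕ→ℚ y ≡ γ + 1ℚ
    γ[1+x] = trans (cong (λ u → α + β + u + ℕ→ℚ y) (ℕ→ℚ-suc x))
          (solve 4 (λ a b c d → a :+ b :+ (con 1ℚ :+ c) :+ d := a :+ b :+ c :+ d :+ con 1ℚ) refl α β (ℕ→ℚ x) (ℕ→ℚ y))
    γ[1+y] : α + β + ℕ→ℚ x + ℕ→ℚ (suc y) ≡ γ + 1ℚ
    γ[1+y] = trans (cong (λ u → α + β + ℕ→ℚ x + u) (ℕ→ℚ-suc y))
          (solve 4 (λ a b c d → a :+ b :+ c :+ (con 1ℚ :+ d) := a :+ b :+ c :+ d :+ con 1ℚ) refl α β (ℕ→ℚ x) (ℕ→ℚ y))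

chuVandermonde : ∀ K α β x y → binomSum K (λ x y → poch α x * poch β y) x y ≡ poch α x * poch β y * poch (α + β + ℕ→ℚ x + ℕ→ℚ y) K
chuVandermonde K α β x y = trans (binomSum-cong K (λ x y → sym (*-identityʳ (poch α x * poch β y))) x y) (chuVandermonde-gen K 0 α β x y)

-- Multiplication of power series
boolℚ : Bool → ℚ
boolℚ b = if b then 1ℚ else 0ℚ

vecEqℚ : ∀ {N} → Vec ℕ N → Vec ℕ N → ℚ
vecEqℚ e v = if does (VP.≡-dec ℕ._≟_ e v) then 1ℚ else 0ℚ

vecEqℚ-∷ : ∀ {N} k u (e v : Vec ℕ N) → vecEqℚ (k ∷ e) (u ∷ v) ≡ boolℚ (does (k ℕ.≟ u)) * vecEqℚ e v
vecEqℚ-∷ k u e v with does (k ℕ.≟ u)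
... | true = sym (*-identityˡ (vecEqℚ e v))
... | false = sym (*-zeroˡ (vecEqℚ e v))

boolℚ-≟0 : ∀ k → boolℚ (does (k ℕ.≟ 0)) ≡ δ₀ k
boolℚ-≟0 zero = refl
boolℚ-≟0 (suc k) = refl

oneₚ-∷ : ∀ {N} k (e : Vec ℕ N) → oneₚ (k ∷ e) ≡ δ₀ k * oneₚ e
oneₚ-∷ k e = trans (vecEqℚ-∷ k 0 e (replicate _ 0)) (cong (_* oneₚ e) (boolℚ-≟0 k))

Σ∈-splits-∷ : ∀ {N} k (e : Vec ℕ N) (F : Vec ℕ (suc N) × Vec ℕ (suc N) → ℚ) →
  Σ∈ (splits (k ∷ e)) F ≡ ∑ (suc k) (λ i → Σ∈ (splits e) (λ p → F (i ∷ proj₁ p , (k ∸ i) ∷ proj₂ p)))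
Σ∈-splits-∷ k e F = trans (Σ∈-concatMap (upTo (suc k)) (λ i → map (λ z → (i ∷ proj₁ z , (k ∸ i) ∷ proj₂ z)) (splits e)) F)
  (Σ∈-cong (upTo (suc k)) (λ i → Σ∈-map (splits e) (λ z → (i ∷ proj₁ z , (k ∸ i) ∷ proj₂ z)) F))

slice : ∀ {N} → PS (suc N) → ℕ → PS N
slice f i d = f (i ∷ d)

⊛-∷ : ∀ {N} (f g : PS (suc N)) k (e : Vec ℕ N) → (f ⊛ g) (k ∷ e) ≡ ∑ (suc k) (λ i → (slice f i ⊛ slice g (k ∸ i)) e)
⊛-∷ f g k e = Σ∈-splits-∷ k e (λ p → f (proj₁ p) * g (proj₂ p))

⊛-cong : ∀ {N} {f f' g g' : PS N} → (∀ d → f d ≡ f' d) → (∀ d → g d ≡ g' d) → ∀ e → (f ⊛ g) e ≡ (f' ⊛ g') e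
⊛-cong ef eg e = Σ∈-cong (splits e) (λ { (d , d') → cong₂ _*_ (ef d) (eg d') })

⊛-∑ˡ : ∀ {N} n (F : ℕ → PS N) (H : PS N) e → ((λ d → ∑ n (λ a → F a d)) ⊛ H) e ≡ ∑ n (λ a → (F a ⊛ H) e)
⊛-∑ˡ n F H e = trans (Σ∈-cong (splits e) (λ p → sym (Σ∈-*ʳ (upTo n) (H (proj₂ p)) (λ a → F a (proj₁ p)))))
  (Σ∈-swap (splits e) (upTo n) (λ p a → F a (proj₁ p) * H (proj₂ p)))

⊛-∑ʳ : ∀ {N} n (F : PS N) (G : ℕ → PS N) e → (F ⊛ (λ d → ∑ n (λ b → G b d))) e ≡ ∑ n (λ b → (F ⊛ G b) e)
⊛-∑ʳ n F G e = trans (Σ∈-cong (splits e) (λ p → sym (Σ∈-*ˡ (upTo n) (F (proj₁ p)) (λ b → G b (proj₂ p)))))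
  (Σ∈-swap (splits e) (upTo n) (λ p b → F (proj₁ p) * G b (proj₂ p)))

⊛-identityʳ : ∀ {N} (g : PS N) e → (g ⊛ oneₚ) e ≡ g e
⊛-identityʳ g [] = solve 1 (λ a → a :* con 1ℚ :+ con 0ℚ := a) refl (g [])
⊛-identityʳ g (k ∷ e) = begin
  (g ⊛ oneₚ) (k ∷ e) ≡⟨ ⊛-∷ g oneₚ k e ⟩
  ∑ (suc k) (λ i → (slice g i ⊛ slice oneₚ (k ∸ i)) e) ≡⟨ ∑-delta (suc k) k _ (ℕP.n<1+n k) vanishes ⟩
  (slice g k ⊛ slice oneₚ (k ∸ k)) e ≡⟨ ⊛-cong {f = slice g k} (λ d → refl) (λ d → trans (cong (λ t → oneₚ (t ∷ d)) (ℕP.n∸n≡0 k)) (trans (oneₚ-∷ 0 d) (*-identityˡ (oneₚ d)))) e ⟩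
  (slice g k ⊛ oneₚ) e ≡⟨ ⊛-identityʳ (slice g k) e ⟩
  g (k ∷ e) ∎
  where
  open ≡-Reasoning
  vanishes : ∀ i → i < suc k → i ≢ k → (slice g i ⊛ slice oneₚ (k ∸ i)) e ≡ 0ℚ
  vanishes i i<sk i≢k = Σ∈-0 (splits e) _ (λ p → trans (cong (g (i ∷ proj₁ p) *_) (trans (oneₚ-∷ (k ∸ i) (proj₂ p))
        (trans (cong (_* oneₚ (proj₂ p)) (δ₀-pos (k ∸ i) (ℕP.m<n⇒0<n∸m (ℕP.≤∧≢⇒< (ℕP.≤-pred i<sk) i≢k)))) (*-zeroˡ (oneₚ (proj₂ p))))))
        (*-zeroʳ (g (i ∷ proj₁ p))))

⊛-assoc : ∀ {N} (f g h : PS N) e → ((f ⊛ g) ⊛ h) e ≡ (f ⊛ (g ⊛ h)) e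
⊛-assoc f g h [] = solve 3 (λ a b c → (a :* b :+ con 0ℚ) :* c :+ con 0ℚ := a :* (b :* c :+ con 0ℚ) :+ con 0ℚ) refl (f []) (g []) (h [])
⊛-assoc f g h (k ∷ e) = begin
  ((f ⊛ g) ⊛ h) (k ∷ e) ≡⟨ ⊛-∷ (f ⊛ g) h k e ⟩
  ∑ (suc k) (λ i → (slice (f ⊛ g) i ⊛ slice h (k ∸ i)) e)
    ≡⟨ Σ∈-cong (upTo (suc k)) (λ i →
         trans (⊛-cong {f = slice (f ⊛ g) i} {f' = λ d → ∑ (suc i) (λ a → (slice f a ⊛ slice g (i ∸ a)) d)} (λ d → ⊛-∷ f g i d) (λ d → refl) e)
         (trans (⊛-∑ˡ (suc i) (λ a → slice f a ⊛ slice g (i ∸ a)) (slice h (k ∸ i)) e)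
                (Σ∈-cong (upTo (suc i)) (λ a → ⊛-assoc (slice f a) (slice g (i ∸ a)) (slice h (k ∸ i)) e)))) ⟩
  ∑ (suc k) (λ i → ∑ (suc i) (λ a → T a (i ∸ a) (k ∸ i))) ≡⟨ ∑-triangle k T ⟩
  ∑ (suc k) (λ a → ∑ (suc (k ∸ a)) (λ b → T a b (k ∸ a ∸ b)))
    ≡⟨ Σ∈-cong (upTo (suc k)) (λ a → sym
         (trans (⊛-cong {f = slice f a} {g = slice (g ⊛ h) (k ∸ a)} {g' = λ d → ∑ (suc (k ∸ a)) (λ b → (slice g b ⊛ slice h (k ∸ a ∸ b)) d)} (λ d → refl) (λ d → ⊛-∷ g h (k ∸ a) d) e)
                (⊛-∑ʳ (suc (k ∸ a)) (slice f a) (λ b → slice g b ⊛ slice h (k ∸ a ∸ b)) e))) ⟩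
  ∑ (suc k) (λ a → (slice f a ⊛ slice (g ⊛ h) (k ∸ a)) e) ≡⟨ sym (⊛-∷ f (g ⊛ h) k e) ⟩
  (f ⊛ (g ⊛ h)) (k ∷ e) ∎
  where
  open ≡-Reasoning
  T : ℕ → ℕ → ℕ → ℚ
  T a b c = (slice f a ⊛ (slice g b ⊛ slice h c)) e

x⊛y≡z⇒x≡z⊛y⁻¹ : ∀ {N} (x y z y⁻¹ : PS N) → (∀ e → (x ⊛ y) e ≡ z e) → (∀ e → (y ⊛ y⁻¹) e ≡ oneₚ e) →
  ∀ e → x e ≡ (z ⊛ y⁻¹) e
x⊛y≡z⇒x≡z⊛y⁻¹ x y z y⁻¹ xy≡z yy⁻¹≡1 e = begin
  x e                  ≡⟨ sym (⊛-identityʳ x e) ⟩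
  (x ⊛ oneₚ) e         ≡⟨ ⊛-cong {f = x} (λ _ → refl) (λ d → sym (yy⁻¹≡1 d)) e ⟩
  (x ⊛ (y ⊛ y⁻¹)) e    ≡⟨ sym (⊛-assoc x y y⁻¹ e) ⟩
  ((x ⊛ y) ⊛ y⁻¹) e    ≡⟨ ⊛-cong xy≡z (λ _ → refl) e ⟩
  (z ⊛ y⁻¹) e ∎
  where open ≡-Reasoning

-- Exponential-type series
-- χ m e is 1 if e vanishes outside its first m entries and 0 otherwise; prefixDeg m e is the
-- sum of those first m entries.
χ : ∀ {N} → ℕ → Vec ℕ N → ℚ
χ m [] = 1ℚ
χ zero (k ∷ e) = δ₀ k * χ zero e
χ (suc m) (k ∷ e) = χ m e

prefixDeg : ∀ {N} → ℕ → Vec ℕ N → ℕ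
prefixDeg m [] = 0
prefixDeg zero (k ∷ e) = 0
prefixDeg (suc m) (k ∷ e) = k ℕ.+ prefixDeg m e

invFactVec : ∀ {N} → Vec ℕ N → ℚ
invFactVec [] = 1ℚ
invFactVec (k ∷ e) = invFact k * invFactVec e

prefixDeg-0 : ∀ {N} (e : Vec ℕ N) → prefixDeg 0 e ≡ 0
prefixDeg-0 [] = refl
prefixDeg-0 (k ∷ e) = refl

χ-cases : ∀ {N} m (e : Vec ℕ N) → χ m e ≡ 0ℚ ⊎ (χ m e ≡ 1ℚ × prefixDeg m e ≡ deg e)
χ-cases m [] = inj₂ (refl , refl)
χ-cases zero (suc k ∷ e) = inj₁ (*-zeroˡ (χ zero e))
χ-cases zero (zero ∷ e) with χ-cases zero e
... | inj₁ eq = inj₁ (trans (*-identityˡ (χ zero e)) eq)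
... | inj₂ (eq , dg) = inj₂ (trans (*-identityˡ (χ zero e)) eq , trans (sym (prefixDeg-0 e)) dg)
χ-cases (suc m) (k ∷ e) with χ-cases m e
... | inj₁ eq = inj₁ eq
... | inj₂ (eq , dg) = inj₂ (eq , cong (k ℕ.+_) dg)

χ-head : ℕ → ℕ → ℚ
χ-head zero k = δ₀ k
χ-head (suc _) k = 1ℚ

χ-∷ : ∀ {N} m k (e : Vec ℕ N) → χ m (k ∷ e) ≡ χ-head m k * χ (ℕ.pred m) e
χ-∷ zero k e = refl
χ-∷ (suc m) k e = sym (*-identityˡ (χ m e))

kernelTerm : ∀ {N} → ℕ → ℕ → Kernel → Vec ℕ N × Vec ℕ N → ℚ
kernelTerm m m' Φ (d , d') = χ m d * χ m' d' * Φ (deg d) (deg d') * (invFactVec d * invFactVec d')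

Σ∈-kernelTerm-∷-zero : ∀ {N} m' k (e : Vec ℕ N) (Φ : Kernel) →
  Σ∈ (splits (k ∷ e)) (kernelTerm 0 m' Φ)
    ≡ χ-head m' k * invFact k * Σ∈ (splits e) (kernelTerm 0 (ℕ.pred m') (λ x y → Φ x (k ℕ.+ y)))
Σ∈-kernelTerm-∷-zero m' k e Φ = begin
  Σ∈ (splits (k ∷ e)) (kernelTerm 0 m' Φ) ≡⟨ Σ∈-splits-∷ k e (kernelTerm 0 m' Φ) ⟩
  ∑ (suc k) (λ i → Σ∈ (splits e) (λ p → kernelTerm 0 m' Φ (i ∷ proj₁ p , (k ∸ i) ∷ proj₂ p)))
    ≡⟨ ∑-delta (suc k) 0 _ (s≤s z≤n) head≢0 ⟩
  Σ∈ (splits e) (λ p → kernelTerm 0 m' Φ (0 ∷ proj₁ p , k ∷ proj₂ p)) ≡⟨ Σ∈-cong (splits e) head≡0 ⟩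
  Σ∈ (splits e) (λ p → c * kernelTerm 0 (ℕ.pred m') Φ′ p)          ≡⟨ Σ∈-*ˡ (splits e) c (kernelTerm 0 (ℕ.pred m') Φ′) ⟩
  c * Σ∈ (splits e) (kernelTerm 0 (ℕ.pred m') Φ′) ∎
  where
  open ≡-Reasoning
  c : ℚ
  c = χ-head m' k * invFact k
  Φ′ : Kernel
  Φ′ x y = Φ x (k ℕ.+ y)
  head≢0 : ∀ i → i < suc k → i ≢ 0 → Σ∈ (splits e) (λ p → kernelTerm 0 m' Φ (i ∷ proj₁ p , (k ∸ i) ∷ proj₂ p)) ≡ 0ℚ
  head≢0 zero _ i≢0 = ⊥-elim (i≢0 refl)
  head≢0 (suc i) _ _ = Σ∈-0 (splits e) _ (λ { (d , d') →
    solve 4 (λ a b c f → con 0ℚ :* a :* b :* c :* f := con 0ℚ) refl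
      (χ 0 d) (χ m' ((k ∸ suc i) ∷ d')) (Φ (suc i ℕ.+ deg d) ((k ∸ suc i) ℕ.+ deg d'))
      (invFact (suc i) * invFactVec d * (invFact (k ∸ suc i) * invFactVec d')) })
  head≡0 : ∀ p → kernelTerm 0 m' Φ (0 ∷ proj₁ p , k ∷ proj₂ p) ≡ c * kernelTerm 0 (ℕ.pred m') Φ′ p
  head≡0 (d , d') = trans
    (cong (λ t → 1ℚ * χ 0 d * t * Φ (deg d) (k ℕ.+ deg d') * (1ℚ * invFactVec d * (invFact k * invFactVec d'))) (χ-∷ m' k d'))
    (solve 7 (λ h x x' ph f fd fd' → con 1ℚ :* x :* (h :* x') :* ph :* (con 1ℚ :* fd :* (f :* fd'))
                                    := h :* f :* (x :* x' :* ph :* (fd :* fd'))) refl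
       (χ-head m' k) (χ 0 d) (χ (ℕ.pred m') d') (Φ (deg d) (k ℕ.+ deg d')) (invFact k) (invFactVec d) (invFactVec d'))

Σ∈-kernelTerm-∷-suc : ∀ {N} a b k (e : Vec ℕ N) (Φ : Kernel) →
  Σ∈ (splits (k ∷ e)) (kernelTerm (suc a) (suc b) Φ)
    ≡ ∑ (suc k) (λ i → invFact i * invFact (k ∸ i) * Σ∈ (splits e) (kernelTerm a b (λ x y → Φ (i ℕ.+ x) ((k ∸ i) ℕ.+ y))))
Σ∈-kernelTerm-∷-suc a b k e Φ = trans (Σ∈-splits-∷ k e (kernelTerm (suc a) (suc b) Φ)) (Σ∈-cong (upTo (suc k)) column)
  where
  column : ∀ i → Σ∈ (splits e) (λ p → kernelTerm (suc a) (suc b) Φ (i ∷ proj₁ p , (k ∸ i) ∷ proj₂ p))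
               ≡ invFact i * invFact (k ∸ i) * Σ∈ (splits e) (kernelTerm a b (λ x y → Φ (i ℕ.+ x) ((k ∸ i) ℕ.+ y)))
  column i = trans
    (Σ∈-cong (splits e) (λ { (d , d') →
      solve 7 (λ x x' ph fi fk fd fd' → x :* x' :* ph :* (fi :* fd :* (fk :* fd')) := fi :* fk :* (x :* x' :* ph :* (fd :* fd'))) refl
        (χ a d) (χ b d') (Φ (i ℕ.+ deg d) ((k ∸ i) ℕ.+ deg d')) (invFact i) (invFact (k ∸ i)) (invFactVec d) (invFactVec d') }))
    (Σ∈-*ˡ (splits e) (invFact i * invFact (k ∸ i)) _)

-- The multinomial theorem; a general kernel Φ in place of φ x * ψ y lets the induction over
-- coordinates go through.
Σ∈-kernelTerm : ∀ {N} m m' → m ≤ m' → (e : Vec ℕ N) (Φ : Kernel) →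
  Σ∈ (splits e) (kernelTerm m m' Φ) ≡ χ m' e * binomSum (prefixDeg m e) Φ 0 (deg e ∸ prefixDeg m e) * invFactVec e
Σ∈-kernelTerm m m' _ [] Φ = solve 1 (λ a → con 1ℚ :* con 1ℚ :* a :* (con 1ℚ :* con 1ℚ) :+ con 0ℚ := con 1ℚ :* a :* con 1ℚ) refl (Φ 0 0)
Σ∈-kernelTerm zero m' _ (k ∷ e) Φ = begin
  Σ∈ (splits (k ∷ e)) (kernelTerm 0 m' Φ) ≡⟨ Σ∈-kernelTerm-∷-zero m' k e Φ ⟩
  c * Σ∈ (splits e) (kernelTerm 0 (ℕ.pred m') Φ′) ≡⟨ cong (c *_) (Σ∈-kernelTerm 0 (ℕ.pred m') z≤n e Φ′) ⟩
  c * (χ (ℕ.pred m') e * binomSum (prefixDeg 0 e) Φ′ 0 (deg e ∸ prefixDeg 0 e) * invFactVec e)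
    ≡⟨ cong (λ t → c * (χ (ℕ.pred m') e * binomSum t Φ′ 0 (deg e ∸ t) * invFactVec e)) (prefixDeg-0 e) ⟩
  c * (χ (ℕ.pred m') e * Φ 0 (k ℕ.+ deg e) * invFactVec e)
    ≡⟨ solve 5 (λ h f x p g → h :* f :* (x :* p :* g) := h :* x :* p :* (f :* g)) refl
         (χ-head m' k) (invFact k) (χ (ℕ.pred m') e) (Φ 0 (k ℕ.+ deg e)) (invFactVec e) ⟩
  χ-head m' k * χ (ℕ.pred m') e * Φ 0 (k ℕ.+ deg e) * invFactVec (k ∷ e)
    ≡⟨ cong (λ t → t * Φ 0 (k ℕ.+ deg e) * invFactVec (k ∷ e)) (sym (χ-∷ m' k e)) ⟩
  χ m' (k ∷ e) * binomSum (prefixDeg 0 (k ∷ e)) Φ 0 (deg (k ∷ e) ∸ prefixDeg 0 (k ∷ e)) * invFactVec (k ∷ e) ∎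
  where
  open ≡-Reasoning
  c : ℚ
  c = χ-head m' k * invFact k
  Φ′ : Kernel
  Φ′ x y = Φ x (k ℕ.+ y)
Σ∈-kernelTerm (suc a) (suc b) (s≤s a≤b) (k ∷ e) Φ = begin
  Σ∈ (splits (k ∷ e)) (kernelTerm (suc a) (suc b) Φ) ≡⟨ Σ∈-kernelTerm-∷-suc a b k e Φ ⟩
  ∑ (suc k) (λ i → f i * Σ∈ (splits e) (kernelTerm a b Φ[ i ])) ≡⟨ Σ∈-cong (upTo (suc k)) column ⟩
  ∑ (suc k) (λ i → Ψ i (k ∸ i) * f i * c)                 ≡⟨ Σ∈-*ʳ (upTo (suc k)) c (λ i → Ψ i (k ∸ i) * f i) ⟩
  expConv k Ψ * c                                       ≡⟨ cong (_* c) (expConv≡binomSum k Ψ) ⟩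
  binomSum k Ψ 0 0 * invFact k * c                      ≡⟨ cong (λ t → t * invFact k * c) (binomSum-nest k l r Φ) ⟩
  binomSum (k ℕ.+ l) Φ 0 r * invFact k * c
    ≡⟨ solve 4 (λ i f x g → i :* f :* (x :* g) := x :* i :* (f :* g)) refl (binomSum (k ℕ.+ l) Φ 0 r) (invFact k) (χ b e) (invFactVec e) ⟩
  χ b e * binomSum (k ℕ.+ l) Φ 0 r * invFactVec (k ∷ e)
    ≡⟨ cong (λ t → χ b e * binomSum (k ℕ.+ l) Φ 0 t * invFactVec (k ∷ e)) (sym (ℕP.[m+n]∸[m+o]≡n∸o k (deg e) l)) ⟩
  χ (suc b) (k ∷ e) * binomSum (prefixDeg (suc a) (k ∷ e)) Φ 0 (deg (k ∷ e) ∸ prefixDeg (suc a) (k ∷ e)) * invFactVec (k ∷ e) ∎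
  where
  open ≡-Reasoning
  l r : ℕ
  l = prefixDeg a e
  r = deg e ∸ l
  c : ℚ
  c = χ b e * invFactVec e
  f : ℕ → ℚ
  f i = invFact i * invFact (k ∸ i)
  Ψ : Kernel
  Ψ x y = binomSum l Φ x (y ℕ.+ r)
  Φ[_] : ℕ → Kernel
  Φ[ i ] x y = Φ (i ℕ.+ x) ((k ∸ i) ℕ.+ y)
  column : ∀ i → f i * Σ∈ (splits e) (kernelTerm a b Φ[ i ]) ≡ Ψ i (k ∸ i) * f i * c
  column i = begin
    f i * Σ∈ (splits e) (kernelTerm a b Φ[ i ])          ≡⟨ cong (f i *_) (Σ∈-kernelTerm a b a≤b e Φ[ i ]) ⟩
    f i * (χ b e * binomSum l Φ[ i ] 0 r * invFactVec e)
      ≡⟨ cong (λ t → f i * (χ b e * t * invFactVec e))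
              (trans (binomSum-shift l Φ i (k ∸ i) 0 r) (cong (λ t → binomSum l Φ t ((k ∸ i) ℕ.+ r)) (ℕP.+-identityʳ i))) ⟩
    f i * (χ b e * Ψ i (k ∸ i) * invFactVec e)
      ≡⟨ solve 4 (λ f x p g → f :* (x :* p :* g) := p :* f :* (x :* g)) refl (f i) (χ b e) (Ψ i (k ∸ i)) (invFactVec e) ⟩
    Ψ i (k ∸ i) * f i * c ∎

expSeries : ∀ {N} → (ℕ → ℚ) → ℕ → PS N
expSeries φ m d = χ m d * φ (deg d) * invFactVec d

expSeries-cong : ∀ {N} {φ ψ : ℕ → ℚ} m → (∀ K → φ K ≡ ψ K) → (d : Vec ℕ N) → expSeries φ m d ≡ expSeries ψ m d
expSeries-cong {φ = φ} {ψ} m eq d = cong (λ t → χ m d * t * invFactVec d) (eq (deg d))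

expSeries-⊛ : ∀ {N} m m' → m ≤ m' → (φ ψ : ℕ → ℚ) (e : Vec ℕ N) →
  (expSeries φ m ⊛ expSeries ψ m') e ≡ χ m' e * binomSum (prefixDeg m e) (λ x y → φ x * ψ y) 0 (deg e ∸ prefixDeg m e) * invFactVec e
expSeries-⊛ m m' le φ ψ e = trans
  (Σ∈-cong (splits e) (λ { (d , d') → solve 8 (λ a b c d f g h i → a :* b :* c :* (d :* f :* g) := a :* d :* (b :* f) :* (c :* g)) refl
       (χ m d) (φ (deg d)) (invFactVec d) (χ m' d') (ψ (deg d')) (invFactVec d') 0ℚ 0ℚ }))
  (Σ∈-kernelTerm m m' le e (λ x y → φ x * ψ y))

binomConv : (ℕ → ℚ) → (ℕ → ℚ) → ℕ → ℚ
binomConv φ ψ K = binomSum K (λ x y → φ x * ψ y) 0 0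

expSeries-⊛-same : ∀ {N} m (φ ψ : ℕ → ℚ) (e : Vec ℕ N) → (expSeries φ m ⊛ expSeries ψ m) e ≡ expSeries (binomConv φ ψ) m e
expSeries-⊛-same m φ ψ e with χ-cases m e
... | inj₁ eq = trans (expSeries-⊛ m m ℕP.≤-refl φ ψ e)
   (trans (cong (λ t → t * binomSum (prefixDeg m e) (λ x y → φ x * ψ y) 0 (deg e ∸ prefixDeg m e) * invFactVec e) eq)
   (trans (0* (binomSum (prefixDeg m e) (λ x y → φ x * ψ y) 0 (deg e ∸ prefixDeg m e)) (invFactVec e))
   (sym (trans (cong (λ t → t * binomConv φ ψ (deg e) * invFactVec e) eq) (0* (binomConv φ ψ (deg e)) (invFactVec e))))))
  where
  0* : ∀ A B → 0ℚ * A * B ≡ 0ℚ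
  0* A B = solve 2 (λ a b → con 0ℚ :* a :* b := con 0ℚ) refl A B
... | inj₂ (eq , dg) = trans (expSeries-⊛ m m ℕP.≤-refl φ ψ e)
   (cong₂ (λ s t → χ m e * binomSum s (λ x y → φ x * ψ y) 0 t * invFactVec e) dg
     (trans (cong (deg e ∸_) dg) (ℕP.n∸n≡0 (deg e))))

-- Binomial series
oneₚ≡expSeries : ∀ {N} m (e : Vec ℕ N) → oneₚ e ≡ expSeries δ₀ m e
oneₚ≡expSeries m [] = refl
oneₚ≡expSeries zero (zero ∷ e) = trans (oneₚ-∷ zero e) (trans (cong (1ℚ *_) (oneₚ≡expSeries zero e))
  (solve 3 (λ a b c → con 1ℚ :* (a :* b :* c) := con 1ℚ :* a :* b :* (con 1ℚ :* c)) refl (χ 0 e) (δ₀ (deg e)) (invFactVec e)))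
oneₚ≡expSeries zero (suc k ∷ e) = trans (oneₚ-∷ (suc k) e)
  (solve 4 (λ o a b c → con 0ℚ :* o := con 0ℚ :* a :* b :* c) refl (oneₚ e) (χ 0 e) (δ₀ (suc k ℕ.+ deg e)) (invFact (suc k) * invFactVec e))
oneₚ≡expSeries (suc m) (zero ∷ e) = trans (oneₚ-∷ zero e) (trans (cong (1ℚ *_) (oneₚ≡expSeries m e))
  (solve 3 (λ a b c → con 1ℚ :* (a :* b :* c) := a :* b :* (con 1ℚ :* c)) refl (χ m e) (δ₀ (deg e)) (invFactVec e)))
oneₚ≡expSeries (suc m) (suc k ∷ e) = trans (oneₚ-∷ (suc k) e)
  (solve 3 (λ o a c → con 0ℚ :* o := a :* con 0ℚ :* c) refl (oneₚ e) (χ m e) (invFact (suc k) * invFactVec e))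

negδ₁ : ℕ → ℚ
negδ₁ zero = 0ℚ
negδ₁ (suc zero) = - 1ℚ
negδ₁ (suc (suc _)) = 0ℚ

negδ₁-suc : ∀ x → negδ₁ (suc x) ≡ - δ₀ x
negδ₁-suc zero = refl
negδ₁-suc (suc x) = refl

negSumTerm : ∀ {N} → ℕ → Vec ℕ N → Fin N → ℚ
negSumTerm m e i = if does (toℕ i ℕ.<? m) then X i e else 0ℚ

Σ-negSumTerm-suc : ∀ {N} m k (e : Vec ℕ N) → Σℚ (map (negSumTerm (suc m) (k ∷ e)) (List.allFin (suc N))) ≡
  boolℚ (does (k ℕ.≟ 1)) * oneₚ e + δ₀ k * Σℚ (map (negSumTerm m e) (List.allFin N))
Σ-negSumTerm-suc {N} m k e = cong₂ _+_ first (begin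
    Σℚ (map (negSumTerm (suc m) (k ∷ e)) (List.tabulate Fin.suc))
      ≡⟨ cong Σℚ (trans (LP.map-tabulate Fin.suc (negSumTerm (suc m) (k ∷ e))) (sym (LP.map-tabulate (λ i → i) (negSumTerm (suc m) (k ∷ e) ∘ Fin.suc)))) ⟩
    Σ∈ (List.allFin N) (negSumTerm (suc m) (k ∷ e) ∘ Fin.suc)
      ≡⟨ Σ∈-cong (List.allFin N) rest ⟩
    Σ∈ (List.allFin N) (λ i → δ₀ k * negSumTerm m e i) ≡⟨ Σ∈-*ˡ (List.allFin N) (δ₀ k) (negSumTerm m e) ⟩
    δ₀ k * Σℚ (map (negSumTerm m e) (List.allFin N)) ∎)
  where
  open ≡-Reasoning
  first : X Fin.zero (k ∷ e) ≡ boolℚ (does (k ℕ.≟ 1)) * oneₚ e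
  first = trans (vecEqℚ-∷ k 1 e (tabulate (λ _ → 0))) (cong (λ v → boolℚ (does (k ℕ.≟ 1)) * vecEqℚ e v)
         (trans (VP.tabulate-cong (λ i → sym (VP.lookup-replicate i 0))) (VP.tabulate∘lookup (replicate N 0))))
  rest : ∀ i → negSumTerm (suc m) (k ∷ e) (Fin.suc i) ≡ δ₀ k * negSumTerm m e i
  rest i with does (toℕ i ℕ.<? m)
  ... | true = trans (vecEqℚ-∷ k 0 e (unitVec i)) (cong (_* X i e) (boolℚ-≟0 k))
  ... | false = sym (*-zeroʳ (δ₀ k))

Σ-negSumTerm-zero : ∀ {N} (e : Vec ℕ N) → Σℚ (map (negSumTerm 0 e) (List.allFin N)) ≡ 0ℚ
Σ-negSumTerm-zero {N} e = Σ∈-0 (List.allFin N) (negSumTerm 0 e) (λ i → refl)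

negSumVars≡expSeries : ∀ {N} m (e : Vec ℕ N) → negSumVars m e ≡ expSeries negδ₁ m e
negSumVars≡expSeries m [] = refl
negSumVars≡expSeries zero (k ∷ e) = trans (cong -_ (Σ-negSumTerm-zero (k ∷ e))) (sym (expSeries≡0 k (χ-cases zero e)))
  where
  expSeries≡0 : ∀ k → χ zero e ≡ 0ℚ ⊎ (χ zero e ≡ 1ℚ × prefixDeg zero e ≡ deg e) → expSeries negδ₁ zero (k ∷ e) ≡ 0ℚ
  expSeries≡0 k (inj₁ eq) = trans (cong (λ t → δ₀ k * t * negδ₁ (k ℕ.+ deg e) * (invFact k * invFactVec e)) eq)
                        (solve 3 (λ a b c → a :* con 0ℚ :* b :* c := con 0ℚ) refl (δ₀ k) (negδ₁ (k ℕ.+ deg e)) (invFact k * invFactVec e))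
  expSeries≡0 zero (inj₂ (eq , dg)) = trans (cong (λ t → δ₀ 0 * χ zero e * negδ₁ t * (invFact 0 * invFactVec e)) (sym (trans (sym (prefixDeg-0 e)) dg)))
                        (solve 2 (λ a c → con 1ℚ :* a :* con 0ℚ :* c := con 0ℚ) refl (χ zero e) (invFact 0 * invFactVec e))
  expSeries≡0 (suc k') (inj₂ _) = solve 3 (λ a b c → con 0ℚ :* a :* b :* c := con 0ℚ) refl (χ zero e) (negδ₁ (suc k' ℕ.+ deg e)) (invFact (suc k') * invFactVec e)
negSumVars≡expSeries (suc m) (k ∷ e) = trans (cong -_ (Σ-negSumTerm-suc m k e)) (trans (cong (λ t → - (boolℚ (does (k ℕ.≟ 1)) * oneₚ e + δ₀ k * t)) (solve 1 (λ s → s := :- (:- s)) refl (Σℚ (map (negSumTerm m e) (List.allFin _))))) (by-head k))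
  where
  by-head : ∀ k → - (boolℚ (does (k ℕ.≟ 1)) * oneₚ e + δ₀ k * (- (- Σℚ (map (negSumTerm m e) (List.allFin _))))) ≡ expSeries negδ₁ (suc m) (k ∷ e)
  by-head zero = trans (solve 2 (λ o s → :- (con 0ℚ :* o :+ con 1ℚ :* (:- s)) := s) refl (oneₚ e) (negSumVars m e))
             (trans (negSumVars≡expSeries m e) (solve 3 (λ a b c → a :* b :* c := a :* b :* (con 1ℚ :* c)) refl (χ m e) (negδ₁ (deg e)) (invFactVec e)))
  by-head (suc zero) = trans (solve 2 (λ o s → :- (con 1ℚ :* o :+ con 0ℚ :* (:- s)) := :- o) refl (oneₚ e) (negSumVars m e))
             (trans (cong -_ (oneₚ≡expSeries m e))
             (trans (solve 3 (λ a b c → :- (a :* b :* c) := a :* (:- b) :* (con 1ℚ :* c)) refl (χ m e) (δ₀ (deg e)) (invFactVec e))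
             (cong (λ t → χ m e * t * (invFact 1 * invFactVec e)) (sym (negδ₁-suc (deg e))))))
  by-head (suc (suc k)) = solve 4 (λ o s a c → :- (con 0ℚ :* o :+ con 0ℚ :* (:- s)) := a :* con 0ℚ :* c) refl (oneₚ e) (negSumVars m e) (χ m e) (invFact (suc (suc k)) * invFactVec e)

negSumPow : ℕ → ℕ → ℚ
negSumPow zero = δ₀
negSumPow (suc j) = binomConv negδ₁ (negSumPow j)

negSumVars^ₚ≡expSeries : ∀ {N} m j (e : Vec ℕ N) → (negSumVars m ^ₚ j) e ≡ expSeries (negSumPow j) m e
negSumVars^ₚ≡expSeries m zero e = oneₚ≡expSeries m e
negSumVars^ₚ≡expSeries m (suc j) e = trans (⊛-cong (negSumVars≡expSeries m) (negSumVars^ₚ≡expSeries m j) e) (expSeries-⊛-same m negδ₁ (negSumPow j) e)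

binomConv-negδ₁-suc : ∀ ψ K → binomConv negδ₁ ψ (suc K) ≡ - (ψ K * ℕ→ℚ (suc K))
binomConv-negδ₁-suc ψ K = begin
  binomConv negδ₁ ψ (suc K) ≡⟨ binomSum≡expConv*fact (suc K) Φ ⟩
  expConv (suc K) Φ * factℚ (suc K) ≡⟨ cong (_* factℚ (suc K)) (∑-delta (suc (suc K)) 1 _ (s≤s (s≤s z≤n)) vanishes) ⟩
  negδ₁ 1 * ψ K * (invFact 1 * invFact K) * factℚ (suc K) ≡⟨ cong (λ t → negδ₁ 1 * ψ K * (invFact 1 * invFact K) * t) (factℚ-suc K) ⟩
  - 1ℚ * ψ K * (1ℚ * invFact K) * (factℚ K * ℕ→ℚ (suc K))
    ≡⟨ solve 4 (λ p i f n → con (- 1ℚ) :* p :* (con 1ℚ :* i) :* (f :* n) := :- (p :* n) :* (i :* f)) refl (ψ K) (invFact K) (factℚ K) (ℕ→ℚ (suc K)) ⟩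
  - (ψ K * ℕ→ℚ (suc K)) * (invFact K * factℚ K) ≡⟨ cong (- (ψ K * ℕ→ℚ (suc K)) *_) (trans (*-comm (invFact K) (factℚ K)) (inv0-inverseʳ (factℚ K) (factℚ≢0 K))) ⟩
  - (ψ K * ℕ→ℚ (suc K)) * 1ℚ ≡⟨ *-identityʳ _ ⟩
  - (ψ K * ℕ→ℚ (suc K)) ∎
  where
  open ≡-Reasoning
  Φ : Kernel
  Φ x y = negδ₁ x * ψ y
  vanishes : ∀ i → i < suc (suc K) → i ≢ 1 → Φ i (suc K ∸ i) * (invFact i * invFact (suc K ∸ i)) ≡ 0ℚ
  vanishes zero _ _ = solve 2 (λ a b → con 0ℚ :* a :* b := con 0ℚ) refl (ψ (suc K)) (invFact 0 * invFact (suc K))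
  vanishes (suc zero) _ ne = ⊥-elim (ne refl)
  vanishes (suc (suc i)) _ _ = solve 2 (λ a b → con 0ℚ :* a :* b := con 0ℚ) refl (ψ (K ∸ suc i)) (invFact (suc (suc i)) * invFact (K ∸ suc i))

sign : ℕ → ℚ
sign zero = 1ℚ
sign (suc j) = - sign j

negSumPow-diag : ∀ j → negSumPow j j ≡ sign j * factℚ j
negSumPow-diag zero = refl
negSumPow-diag (suc j) = trans (binomConv-negδ₁-suc (negSumPow j) j) (trans (cong (λ t → - (t * ℕ→ℚ (suc j))) (negSumPow-diag j))
  (trans (solve 3 (λ s f n → :- (s :* f :* n) := :- s :* (f :* n)) refl (sign j) (factℚ j) (ℕ→ℚ (suc j)))
   (cong (- sign j *_) (sym (factℚ-suc j)))))

negSumPow-off : ∀ j K → K ≢ j → negSumPow j K ≡ 0ℚ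
negSumPow-off zero zero ne = ⊥-elim (ne refl)
negSumPow-off zero (suc K) ne = refl
negSumPow-off (suc j) zero ne = *-zeroˡ (negSumPow j 0)
negSumPow-off (suc j) (suc K) ne = trans (binomConv-negδ₁-suc (negSumPow j) K)
  (trans (cong (λ t → - (t * ℕ→ℚ (suc K))) (negSumPow-off j K (λ eq → ne (cong suc eq))))
   (solve 1 (λ n → :- (con 0ℚ :* n) := con 0ℚ) refl (ℕ→ℚ (suc K))))

binom-poch : ∀ a K → binom a K * (sign K * factℚ K) ≡ poch (- a) K
binom-poch a K = begin
  ∏ K (λ i → a - ℕ→ℚ i) * invFact K * (sign K * factℚ K)
    ≡⟨ solve 4 (λ p i s f → p :* i :* (s :* f) := p :* s :* (i :* f)) refl (∏ K (λ i → a - ℕ→ℚ i)) (invFact K) (sign K) (factℚ K) ⟩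
  ∏ K (λ i → a - ℕ→ℚ i) * sign K * (invFact K * factℚ K)
    ≡⟨ cong (∏ K (λ i → a - ℕ→ℚ i) * sign K *_) (trans (*-comm (invFact K) (factℚ K)) (inv0-inverseʳ (factℚ K) (factℚ≢0 K))) ⟩
  ∏ K (λ i → a - ℕ→ℚ i) * sign K * 1ℚ ≡⟨ *-identityʳ _ ⟩
  ∏ K (λ i → a - ℕ→ℚ i) * sign K ≡⟨ falling*sign K ⟩
  poch (- a) K ∎
  where
  open ≡-Reasoning
  falling*sign : ∀ K → ∏ K (λ i → a - ℕ→ℚ i) * sign K ≡ poch (- a) K
  falling*sign zero = refl
  falling*sign (suc K) = trans (cong (_* sign (suc K)) (∏-last K (λ i → a - ℕ→ℚ i)))
    (trans (solve 4 (λ p s x n → p :* (x :- n) :* (:- s) := p :* s :* (:- x :+ n)) refl (∏ K (λ i → a - ℕ→ℚ i)) (sign K) a (ℕ→ℚ K))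
    (trans (cong (_* (- a + ℕ→ℚ K)) (falling*sign K)) (sym (poch-last (- a) K))))

oneMinusSumPow≡expSeries : ∀ {N} m a (e : Vec ℕ N) → oneMinusSumPow m a e ≡ expSeries (poch (- a)) m e
oneMinusSumPow≡expSeries m a e = begin
  ∑ (suc D) (λ j → binom a j * (negSumVars m ^ₚ j) e)
    ≡⟨ Σ∈-cong (upTo (suc D)) (λ j → trans (cong (binom a j *_) (negSumVars^ₚ≡expSeries m j e))
          (solve 4 (λ b c p f → b :* (c :* p :* f) := b :* p :* (c :* f)) refl (binom a j) (χ m e) (negSumPow j D) (invFactVec e))) ⟩
  ∑ (suc D) (λ j → binom a j * negSumPow j D * (χ m e * invFactVec e)) ≡⟨ Σ∈-*ʳ (upTo (suc D)) (χ m e * invFactVec e) (λ j → binom a j * negSumPow j D) ⟩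
  ∑ (suc D) (λ j → binom a j * negSumPow j D) * (χ m e * invFactVec e)
    ≡⟨ cong (_* (χ m e * invFactVec e)) (∑-delta (suc D) D _ (ℕP.n<1+n D) (λ j _ ne → trans (cong (binom a j *_) (negSumPow-off j D (λ eq → ne (sym eq)))) (*-zeroʳ (binom a j)))) ⟩
  binom a D * negSumPow D D * (χ m e * invFactVec e) ≡⟨ cong (λ t → binom a D * t * (χ m e * invFactVec e)) (negSumPow-diag D) ⟩
  binom a D * (sign D * factℚ D) * (χ m e * invFactVec e) ≡⟨ cong (_* (χ m e * invFactVec e)) (binom-poch a D) ⟩
  poch (- a) D * (χ m e * invFactVec e) ≡⟨ solve 3 (λ p c f → p :* (c :* f) := c :* p :* f) refl (poch (- a) D) (χ m e) (invFactVec e) ⟩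
  expSeries (poch (- a)) m e ∎
  where
  open ≡-Reasoning
  D : ℕ
  D = deg e

oneMinusSumPow-inverse : ∀ {N} m a (d : Vec ℕ N) → (oneMinusSumPow m a ⊛ oneMinusSumPow m (- a)) d ≡ oneₚ d
oneMinusSumPow-inverse m a d = begin
  (oneMinusSumPow m a ⊛ oneMinusSumPow m (- a)) d
    ≡⟨ ⊛-cong (oneMinusSumPow≡expSeries m a) (oneMinusSumPow≡expSeries m (- a)) d ⟩
  (expSeries (poch (- a)) m ⊛ expSeries (poch (- - a)) m) d ≡⟨ expSeries-⊛-same m (poch (- a)) (poch (- - a)) d ⟩
  expSeries (binomConv (poch (- a)) (poch (- - a))) m d     ≡⟨ expSeries-cong m binomConv≡δ₀ d ⟩
  expSeries δ₀ m d                                          ≡⟨ sym (oneₚ≡expSeries m d) ⟩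
  oneₚ d ∎
  where
  open ≡-Reasoning
  binomConv≡δ₀ : ∀ K → binomConv (poch (- a)) (poch (- - a)) K ≡ δ₀ K
  binomConv≡δ₀ K = begin
    binomConv (poch (- a)) (poch (- - a)) K ≡⟨ chuVandermonde K (- a) (- - a) 0 0 ⟩
    1ℚ * 1ℚ * poch (- a + - - a + 0ℚ + 0ℚ) K
      ≡⟨ cong (λ t → 1ℚ * 1ℚ * poch t K) (solve 1 (λ x → :- x :+ :- (:- x) :+ con 0ℚ :+ con 0ℚ := con 0ℚ) refl a) ⟩
    1ℚ * 1ℚ * poch 0ℚ K ≡⟨ *-identityˡ (poch 0ℚ K) ⟩
    poch 0ℚ K           ≡⟨ poch0≡δ₀ K ⟩
    δ₀ K ∎

χ-replicate : ∀ N j → χ N (replicate N j) ≡ 1ℚ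
χ-replicate zero j = refl
χ-replicate (suc N) j = χ-replicate N j

prefixDeg-replicate : ∀ n N j → n ≤ N → prefixDeg n (replicate N j) ≡ n ℕ.* j
prefixDeg-replicate zero N j _ = prefixDeg-0 (replicate N j)
prefixDeg-replicate (suc n) (suc N) j (s≤s n≤N) = cong (j ℕ.+_) (prefixDeg-replicate n N j n≤N)

deg-replicate : ∀ N j → deg (replicate N j) ≡ N ℕ.* j
deg-replicate zero j = refl
deg-replicate (suc N) j = cong (j ℕ.+_) (deg-replicate N j)

invFactVec-replicate : ∀ N j → invFactVec (replicate N j) ≡ powℚ (invFact j) N
invFactVec-replicate zero j = refl
invFactVec-replicate (suc N) j = trans (cong (invFact j *_) (invFactVec-replicate N j)) (sym (∏-first N (λ _ → invFact j)))

Diag-oneMinusSumPow-⊛ : ∀ a b n N → n ≤ N → ∀ j →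
  Diag {N} (oneMinusSumPow n a ⊛ oneMinusSumPow N b) j
    ≡ poch (- a - b + ℕ→ℚ ((N ∸ n) ℕ.* j)) (n ℕ.* j) * poch (- b) ((N ∸ n) ℕ.* j) * powℚ (invFact j) N
Diag-oneMinusSumPow-⊛ a b n N n≤N j = begin
  (oneMinusSumPow n a ⊛ oneMinusSumPow N b) e
    ≡⟨ ⊛-cong (oneMinusSumPow≡expSeries n a) (oneMinusSumPow≡expSeries N b) e ⟩
  (expSeries (poch (- a)) n ⊛ expSeries (poch (- b)) N) e ≡⟨ expSeries-⊛ n N n≤N (poch (- a)) (poch (- b)) e ⟩
  χ N e * binomSum (prefixDeg n e) Φ 0 (deg e ∸ prefixDeg n e) * invFactVec e
    ≡⟨ cong₂ (λ x y → x * binomSum (prefixDeg n e) Φ 0 (deg e ∸ prefixDeg n e) * y) (χ-replicate N j) (invFactVec-replicate N j) ⟩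
  1ℚ * binomSum (prefixDeg n e) Φ 0 (deg e ∸ prefixDeg n e) * I
    ≡⟨ cong₂ (λ u v → 1ℚ * binomSum u Φ 0 v * I) (prefixDeg-replicate n N j n≤N) deg∸prefixDeg ⟩
  1ℚ * binomSum (n ℕ.* j) Φ 0 (s ℕ.* j) * I ≡⟨ cong (λ t → 1ℚ * t * I) (chuVandermonde (n ℕ.* j) (- a) (- b) 0 (s ℕ.* j)) ⟩
  1ℚ * (1ℚ * poch (- b) (s ℕ.* j) * poch (- a + - b + 0ℚ + ℕ→ℚ (s ℕ.* j)) (n ℕ.* j)) * I
    ≡⟨ cong (λ t → 1ℚ * (1ℚ * poch (- b) (s ℕ.* j) * poch t (n ℕ.* j)) * I)
            (solve 3 (λ a b x → :- a :+ :- b :+ con 0ℚ :+ x := :- a :- b :+ x) refl a b (ℕ→ℚ (s ℕ.* j))) ⟩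
  1ℚ * (1ℚ * poch (- b) (s ℕ.* j) * poch (- a - b + ℕ→ℚ (s ℕ.* j)) (n ℕ.* j)) * I
    ≡⟨ solve 3 (λ p q i → con 1ℚ :* (con 1ℚ :* p :* q) :* i := q :* p :* i) refl
         (poch (- b) (s ℕ.* j)) (poch (- a - b + ℕ→ℚ (s ℕ.* j)) (n ℕ.* j)) I ⟩
  poch (- a - b + ℕ→ℚ (s ℕ.* j)) (n ℕ.* j) * poch (- b) (s ℕ.* j) * I ∎
  where
  open ≡-Reasoning
  s : ℕ
  s = N ∸ n
  e : Vec ℕ N
  e = replicate N j
  I : ℚ
  I = powℚ (invFact j) N
  Φ : Kernel
  Φ x y = poch (- a) x * poch (- b) y
  deg∸prefixDeg : deg e ∸ prefixDeg n e ≡ s ℕ.* j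
  deg∸prefixDeg = trans (cong₂ _∸_ (deg-replicate N j) (prefixDeg-replicate n N j n≤N)) (sym (ℕP.*-distribʳ-∸ j N n))

quotient-cancel : ∀ (a b c w p q t u : ℚ) → a * q ≡ c * p * t → b * p ≡ u → c ≢ 0ℚ →
  a * b * inv0 (c * w) * q ≡ t * u * inv0 w
quotient-cancel a b c w p q t u aq≡cpt bp≡u c≢0 = begin
  a * b * inv0 (c * w) * q            ≡⟨ cong (λ x → a * b * x * q) (inv0-* c w) ⟩
  a * b * (inv0 c * inv0 w) * q
    ≡⟨ solve 6 (λ a b ic iw q p → a :* b :* (ic :* iw) :* q := a :* q :* b :* ic :* iw) refl a b (inv0 c) (inv0 w) q p ⟩
  a * q * b * inv0 c * inv0 w         ≡⟨ cong (λ x → x * b * inv0 c * inv0 w) aq≡cpt ⟩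
  c * p * t * b * inv0 c * inv0 w
    ≡⟨ solve 6 (λ c p t b ic iw → c :* p :* t :* b :* ic :* iw := c :* ic :* (t :* (b :* p) :* iw)) refl c p t b (inv0 c) (inv0 w) ⟩
  c * inv0 c * (t * (b * p) * inv0 w) ≡⟨ cong₂ (λ x y → x * (t * y * inv0 w)) (inv0-inverseʳ c c≢0) bp≡u ⟩
  1ℚ * (t * u * inv0 w)               ≡⟨ *-identityˡ (t * u * inv0 w) ⟩
  t * u * inv0 w ∎
  where open ≡-Reasoning

pochProd≢0 : ∀ j xs → Admissible xs → pochProd j xs ≢ 0ℚ
pochProd≢0 j xs adm = Πℚ-≢0 (map (λ a → poch a j) xs)
  (AllP.map⁺ (All.map (λ {b} b+i≢0 → ∏-≢0 j (λ i → b + ℕ→ℚ i) (λ i _ → b+i≢0 i)) adm))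

pochProd-ones : ∀ j k → pochProd j (map (λ _ → 1ℚ) (upTo k)) ≡ powℚ (factℚ j) k
pochProd-ones j k = trans (cong Πℚ (sym (LP.map-∘ (upTo k)))) (∏-cong k (λ _ → ∏-cong j (λ i → sym (ℕ→ℚ-suc i))))

scaleArg-hypergeom : ∀ R S n N → 1 ≤ N → n ≤ N → Admissible (botParams R S n N) → ∀ j →
  scaleArg (ℕ→ℚ (N ^ N)) (hypergeom (topParams R S n N) (botParams R S n N)) j
    ≡ poch (S - R + ℕ→ℚ ((N ∸ n) ℕ.* j)) (n ℕ.* j) * poch S ((N ∸ n) ℕ.* j) * powℚ (invFact j) N
scaleArg-hypergeom R S n N 1≤N n≤N adm j = begin
  pochProd j (fracList Q N ++ fracList S s) * inv0 (pochProd j (fracList Q s ++ ones) * F) * powℚ (ℕ→ℚ (N ^ N)) j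
    ≡⟨ cong₂ (λ u v → u * inv0 (v * F) * powℚ (ℕ→ℚ (N ^ N)) j) (pochProd-++ j (fracList Q N) (fracList S s)) (pochProd-++ j (fracList Q s) ones) ⟩
  ΠQN * ΠSs * inv0 (ΠQs * Π1 * F) * powℚ (ℕ→ℚ (N ^ N)) j
    ≡⟨ cong₂ (λ u v → ΠQN * ΠSs * inv0 u * v) (*-assoc ΠQs Π1 F) (trans (cong (λ t → powℚ t j) (ℕ→ℚ-^ N N)) (powℚ-* (ℕ→ℚ N) N j)) ⟩
  ΠQN * ΠSs * inv0 (ΠQs * (Π1 * F)) * powℚ (ℕ→ℚ N) (N ℕ.* j)
    ≡⟨ quotient-cancel ΠQN ΠSs ΠQs (Π1 * F) (powℚ (ℕ→ℚ s) (s ℕ.* j)) (powℚ (ℕ→ℚ N) (N ℕ.* j)) pQn pSs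
         ΠQN*N^Nj≡ΠQs*s^sj*pQn (gauss-multiplication S s j) (pochProd≢0 j (fracList Q s) (AllP.++⁻ˡ (fracList Q s) adm)) ⟩
  pQn * pSs * inv0 (Π1 * F)
    ≡⟨ cong (λ t → pQn * pSs * inv0 t) (trans (cong (_* F) (pochProd-ones j (N ∸ 1))) (sym (∏-last (N ∸ 1) (λ _ → F)))) ⟩
  pQn * pSs * inv0 (powℚ F (suc (N ∸ 1))) ≡⟨ cong (λ t → pQn * pSs * inv0 (powℚ F t)) (ℕP.m+[n∸m]≡n 1≤N) ⟩
  pQn * pSs * inv0 (powℚ F N)             ≡⟨ cong (pQn * pSs *_) (inv0-powℚ F N) ⟩
  pQn * pSs * powℚ (invFact j) N ∎
  where
  open ≡-Reasoning
  Q F ΠQN ΠSs ΠQs Π1 pQn pSs : ℚ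
  Q = S - R
  s : ℕ
  s = N ∸ n
  F = factℚ j
  ones : List ℚ
  ones = map (λ _ → 1ℚ) (upTo (N ∸ 1))
  ΠQN = pochProd j (fracList Q N)
  ΠSs = pochProd j (fracList S s)
  ΠQs = pochProd j (fracList Q s)
  Π1 = pochProd j ones
  pQn = poch (Q + ℕ→ℚ (s ℕ.* j)) (n ℕ.* j)
  pSs = poch S (s ℕ.* j)
  ΠQN*N^Nj≡ΠQs*s^sj*pQn : ΠQN * powℚ (ℕ→ℚ N) (N ℕ.* j) ≡ ΠQs * powℚ (ℕ→ℚ s) (s ℕ.* j) * pQn
  ΠQN*N^Nj≡ΠQs*s^sj*pQn = begin
    ΠQN * powℚ (ℕ→ℚ N) (N ℕ.* j)        ≡⟨ gauss-multiplication Q N j ⟩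
    poch Q (N ℕ.* j)                  ≡⟨ cong (poch Q) (trans (cong (ℕ._* j) (sym (ℕP.m∸n+n≡m n≤N))) (ℕP.*-distribʳ-+ j s n)) ⟩
    poch Q (s ℕ.* j ℕ.+ n ℕ.* j)      ≡⟨ poch-+ Q (s ℕ.* j) (n ℕ.* j) ⟩
    poch Q (s ℕ.* j) * pQn            ≡⟨ cong (_* pQn) (sym (gauss-multiplication Q s j)) ⟩
    ΠQs * powℚ (ℕ→ℚ s) (s ℕ.* j) * pQn ∎

theorem1 : (R S : ℚ) (n N : ℕ) → S ≢ 0ℚ → n ≤ N → 1 ≤ N →
    Admissible (botParams R S n N) →
    (g : PS N) →
    (∀ e → (g ⊛ oneMinusSumPow N S) e ≡ oneMinusSumPow n R e) →
    ∀ j → scaleArg (ℕ→ℚ (N ^ N)) (hypergeom (topParams R S n N) (botParams R S n N)) j ≡ Diag g j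
theorem1 R S n N _ n≤N 1≤N adm g g⊛[1-x]^S≡[1-x]^R j = begin
  scaleArg (ℕ→ℚ (N ^ N)) (hypergeom (topParams R S n N) (botParams R S n N)) j
    ≡⟨ scaleArg-hypergeom R S n N 1≤N n≤N adm j ⟩
  poch (S - R + x) (n ℕ.* j) * poch S ((N ∸ n) ℕ.* j) * I
    ≡⟨ cong₂ (λ u v → poch u (n ℕ.* j) * poch v ((N ∸ n) ℕ.* j) * I)
             (solve 3 (λ r s x → s :- r :+ x := :- r :- (:- s) :+ x) refl R S x) (solve 1 (λ s → s := :- (:- s)) refl S) ⟩
  poch (- R - - S + x) (n ℕ.* j) * poch (- - S) ((N ∸ n) ℕ.* j) * I
    ≡⟨ sym (Diag-oneMinusSumPow-⊛ R (- S) n N n≤N j) ⟩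
  Diag {N} (oneMinusSumPow n R ⊛ oneMinusSumPow N (- S)) j
    ≡⟨ sym (x⊛y≡z⇒x≡z⊛y⁻¹ g (oneMinusSumPow N S) (oneMinusSumPow n R) (oneMinusSumPow N (- S))
              g⊛[1-x]^S≡[1-x]^R (oneMinusSumPow-inverse N S) (replicate N j)) ⟩
  Diag g j ∎
  where
  open ≡-Reasoning
  x I : ℚ
  x = ℕ→ℚ ((N ∸ n) ℕ.* j)
  I = powℚ (invFact j) N
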